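{- Let $P$ be an Eulerian Sheffer poset whose binomial factorial function satisfies $B(0)=1$ and $B(n) = 2^{n-1}$ for $n \geq 1$, and let $C(n)$ be its coatom function. Then: (i) $C(3) \geq 2$, and every Sheffer interval of length $3$ is isomorphic to a poset of the form $P_{q_1,\ldots,q_r}$; (ii) $C(2m) = 2$ for all $m \geq 2$, and the two coatoms of a Sheffer interval of length $2m$ cover exactly the same elements of rank $2m-2$; (iii) for $m \geq 2$, $C(2m+1) = h$ is an even positive integer, and the set of $h$ coatoms of a Sheffer interval of length $2m+1$ can be partitioned into $h/2$ pairs $\{c_1,d_1\},\ldots,\{c_{h/2},d_{h/2}\}$ such that $c_i$ and $d_i$ cover the same two elements of rank $2m-1$.
   Context: All posets are locally finite with a unique minimal element $\hat 0$. A Sheffer poset is such a poset $P$ that (i) contains an infinite chain, (ii) has every interval graded (rank function $\rho$, $\rho(\hat0)=0$; $[x,y]$ is an $n$-interval if $\rho(y)-\rho(x)=n$), (iii) any two $n$-intervals $[\hat0,y]$, $[\hat0,v]$ with $y,v\neq\hat0$ have the same number $D(n)$ of maximal chains, and (iv) any two $n$-intervals $[x,y]$, $[u,v]$ with $x,u\neq\hat0$ have the same number $B(n)$ of maximal chains. Intervals $[\hat0,y]$ are Sheffer intervals; $B$ and $D$ are the binomial and Sheffer factorial functions. The coatom function is $C(n)=D(n)/D(n-1)$ (the number of coatoms of a Sheffer $n$-interval), with $C(1)=D(1)=1$. A poset is Eulerian if $\mu(x,y)=(-1)^{\rho(y)-\rho(x)}$ for all $x\le y$. For $q \geq 2$,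 $P_q$ is the face poset of a $q$-gon (empty face, $q$ vertices, $q$ edges, the whole polygon), a graded poset of rank $3$. For integers $q_1,\ldots,q_r \geq 2$, $P_{q_1,\ldots,q_r}$ is obtained from $P_{q_1},\ldots,P_{q_r}$ by identifying all their minimal elements into one and all their maximal elements into one. -}

module Defs where

open import Data.Nat using (ℕ; zero; suc; _+_; _*_; _∸_; _^_; _≤_; _<_; _≟_; _<?_)
open import Data.Nat.DivMod using (_/_)
open import Data.Integer as ℤ using (ℤ; +_; -_)
open import Data.List using (List; []; _∷_; filter; map; foldr)
open import Data.Nat.ListAction using (sum)
open import Relation.Nullary using (yes; no)
open import Data.List.Membership.Propositional using (_∈_)
open import Data.List.Relation.Unary.Unique.Propositional using (Unique)
open import Data.Vec using (Vec; lookup)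
open import Data.Fin using (Fin; toℕ)
open import Data.Product using (Σ; _×_; _,_; proj₁; proj₂)
open import Data.Sum using (_⊎_)
open import Function.Bundles using (_⇔_)
open import Relation.Binary.PropositionalEquality using (_≡_; _≢_)
open import Relation.Binary.Structures using (IsPartialOrder)

record GradedPoset : Set₁ where
  field
    Carrier : Set
    _≼_ : Carrier → Carrier → Set
    isPartialOrder : IsPartialOrder _≡_ _≼_
    0̂ : Carrier
    0̂-min : ∀ x → 0̂ ≼ x
    -- local finiteness: every interval [x,y] is enumerated by a
    -- duplicate-free finite list
    interval : Carrier → Carrier → List Carrier
    interval-unique : ∀ x y → Unique (interval x y)
    interval-spec : ∀ x y z → (z ∈ interval x y) ⇔ (x ≼ z × z ≼ y)
    ρ : Carrier → ℕ
    ρ-0̂ : ρ 0̂ ≡ 0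
    ρ-cover : ∀ x y → x ≼ y → x ≢ y →
              (∀ w → x ≼ w → w ≼ y → w ≡ x ⊎ w ≡ y) → ρ y ≡ suc (ρ x)

  _≺_ : Carrier → Carrier → Set
  x ≺ y = x ≼ y × x ≢ y

  _⋖_ : Carrier → Carrier → Set
  x ⋖ y = x ≺ y × (∀ w → x ≼ w → w ≼ y → w ≡ x ⊎ w ≡ y)

  -- number of maximal chains of [x,y]: a maximal chain of a graded
  -- interval is a sequence x = z₀ ⋖ z₁ ⋖ ⋯ ⋖ zₙ = y, and in a graded poset
  -- z ⋖ w iff z ≼ w and ρ w = ρ z + 1.
  chainsFuel : ℕ → Carrier → Carrier → ℕ
  chainsFuel zero x y = 1
  chainsFuel (suc n) x y =
    sum (map (λ z → chainsFuel n z y)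
             (filter (λ z → ρ z ≟ suc (ρ x)) (interval x y)))

  maxChains : Carrier → Carrier → ℕ
  maxChains x y = chainsFuel (ρ y ∸ ρ x) x y

  -- Möbius function: μ(x,x) = 1, μ(x,y) = - Σ_{x ≤ z < y} μ(x,z)
  -- (recursion on the rank difference, with fuel)
  sumℤ : List ℤ → ℤ
  sumℤ = foldr ℤ._+_ (+ 0)

  μFuel : ℕ → Carrier → Carrier → ℤ
  μFuel zero x y = + 1
  μFuel (suc k) x y with ρ x <? ρ y
  ... | no _ = + 1
  ... | yes _ =
        - sumℤ (map (λ z → μFuel k x z)
                    (filter (λ z → ρ z <? ρ y) (interval x y)))

  μ : Carrier → Carrier → ℤ
  μ x y = μFuel (suc (ρ y ∸ ρ x)) x y

sign : ℕ → ℤ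
sign zero = + 1
sign (suc n) = - sign n

IsEulerian : GradedPoset → Set
IsEulerian P = ∀ x y → x ≼ y → μ x y ≡ sign (ρ y ∸ ρ x)
  where open GradedPoset P

record IsSheffer (P : GradedPoset) : Set where
  open GradedPoset P
  field
    chainSeq : ℕ → Carrier
    chain-injective : ∀ i j → chainSeq i ≡ chainSeq j → i ≡ j
    chain-comparable : ∀ i j → chainSeq i ≼ chainSeq j ⊎ chainSeq j ≼ chainSeq i
    D : ℕ → ℕ
    D-spec : ∀ y → y ≢ 0̂ → maxChains 0̂ y ≡ D (ρ y)
    B : ℕ → ℕ
    B-spec : ∀ x y → x ≢ 0̂ → x ≼ y → maxChains x y ≡ B (ρ y ∸ ρ x)

  -- coatom function C(n) = D(n) / D(n-1)  (division by 0 never occurs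
  -- for n ≥ 1 in a Sheffer poset; we return 0 in that case)
  C : ℕ → ℕ
  C n with D (n ∸ 1)
  ... | zero = 0
  ... | suc k = D n / suc k

twoPowPred : ℕ → ℕ
twoPowPred zero = 1
twoPowPred (suc n) = 2 ^ n

-- The posets P_{q₁,…,q_r}: face posets of q_i-gons with all minimal
-- elements identified and all maximal elements identified.
-- Vertices of the i-th polygon are 0,…,q_i-1; edge k joins vertices k
-- and k+1 (mod q_i).

data PElem {r : ℕ} (qs : Vec ℕ r) : Set where
  bot  : PElem qs
  top  : PElem qs
  vert : (i : Fin r) → Fin (lookup qs i) → PElem qs
  edge : (i : Fin r) → Fin (lookup qs i) → PElem qs

data _≤Q_ {r : ℕ} {qs : Vec ℕ r} : PElem qs → PElem qs → Set where
  bot≤ : ∀ {x} → bot ≤Q x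
  ≤top : ∀ {x} → x ≤Q top
  v≤v  : ∀ {i j} → vert i j ≤Q vert i j
  e≤e  : ∀ {i k} → edge i k ≤Q edge i k
  v≤e  : ∀ {i j k} →
         (toℕ j ≡ toℕ k ⊎ toℕ j ≡ suc (toℕ k)
                        ⊎ (toℕ j ≡ 0 × suc (toℕ k) ≡ lookup qs i)) →
         vert i j ≤Q edge i k

record IsoToInterval (P : GradedPoset) (x y : GradedPoset.Carrier P)
                     {r : ℕ} (qs : Vec ℕ r) : Set where
  open GradedPoset P
  field
    f : PElem qs → Carrier
    f-in : ∀ p → x ≼ f p × f p ≼ y
    f-onto : ∀ z → x ≼ z → z ≼ y → Σ (PElem qs) (λ p → f p ≡ z)
    f-order : ∀ p q → (p ≤Q q) ⇔ (f p ≼ f q)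

flattenPairs : {A : Set} → List (A × A) → List A
flattenPairs [] = []
flattenPairs ((a , b) ∷ ps) = a ∷ b ∷ flattenPairs ps

-- Since B(n) = 2^(n-1), counting maximal chains shows that every interval [x,y] with x ≠ 0̂ and
-- length at least 2 has exactly two atoms and two coatoms. In a Sheffer interval [0̂,Y] of even
-- length, sum the Euler relation of each coatom over all coatoms: with N(z) the number of coatoms
-- above z, ∑ N(z)(-1)^ρ(z) = 0 = ∑ 2(-1)^ρ(z), and N(z) = 2 except at 0̂, the coatoms and Y, which
-- forces exactly two coatoms. Hence both coatoms cover every element two ranks below Y that either
-- covers, as its two upper covers are coatoms. In odd length the coatoms are tops of even Sheffer
-- intervals, so each covers exactly two elements, and "same lower covers" is an equivalence on the
-- coatoms with classes of size two. In length 3 the atoms and edges form an incidence graph in which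
-- every vertex has degree two; its cycles, traced by walking along flags, are the polygons P_q.
module Submission where

open import Defs
open import Algebra.Structures using (IsCommutativeMonoid)
open import Data.Empty using (⊥; ⊥-elim)
open import Data.Fin as Fin using (Fin; toℕ; fromℕ<)
import Data.Fin.Properties as Finₚ
open import Data.Integer as ℤ using (ℤ; +_; -_; -[1+_])
import Data.Integer.Properties as ℤₚ
open import Data.Integer.Tactic.RingSolver using (solve-∀)
open import Data.List using (List; []; _∷_; length; map; _++_; foldr; filter; lookup; cartesianProduct)
import Data.List.Properties as Listₚ
open import Data.List.Membership.Propositional using (_∈_; _∉_)
open import Data.List.Membership.Propositional.Properties
  using (∈-++⁺ˡ; ∈-++⁺ʳ; ∈-++⁻; ∈-map⁺; ∈-map⁻; ∈-filter⁺; ∈-filter⁻; ∈-cartesianProduct⁺)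
open import Data.List.Membership.Propositional.Properties.WithK using (unique∧set⇒bag)
open import Data.List.Relation.Binary.BagAndSetEquality using (∼bag⇒↭)
open import Data.List.Relation.Binary.Disjoint.Propositional using (Disjoint)
open import Data.List.Relation.Binary.Permutation.Propositional using (_↭_; ↭⇒↭ₛ)
open import Data.List.Relation.Binary.Permutation.Propositional.Properties using (↭-length; map⁺)
import Data.List.Relation.Binary.Permutation.Setoid.Properties as Permutationₛ
open import Data.List.Relation.Binary.Subset.Propositional using (_⊆_)
open import Data.List.Relation.Unary.All as L using ([]; _∷_)
open import Data.List.Relation.Unary.All.Properties using (¬Any⇒All¬)
open import Data.List.Relation.Unary.AllPairs using ([]; _∷_)
open import Data.List.Relation.Unary.Any using (here; there; _─_; index)
open import Data.List.Relation.Unary.Any.Properties using (lookup-index)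
open import Data.List.Relation.Unary.Unique.Propositional using (Unique)
import Data.List.Relation.Unary.Unique.Propositional.Properties as Uniqueₚ
open import Data.Nat using (ℕ; zero; suc; _+_; _*_; _∸_; _^_; _≤_; _<_; z≤n; s≤s; _≟_; _<?_; _≤?_; ⌊_/2⌋)
open import Data.Nat.DivMod using (_/_; m*n/n≡m)
open import Data.Nat.Induction using (<-rec)
open import Data.Nat.ListAction using (sum)
open import Data.Nat.Properties
open import Data.Product using (Σ; _×_; _,_; proj₁; proj₂; swap)
open import Data.Sum as Sum using (_⊎_; inj₁; inj₂; [_,_])
open import Data.Vec as Vec using (Vec; []; _∷_)
open import Data.Vec.Properties using (lookup-map)
open import Data.Vec.Relation.Unary.All using (All; []; _∷_)
open import Function using (_∘_; _∘′_)
open import Function.Bundles using (_⇔_; mk⇔; Equivalence)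
open import Relation.Binary.Definitions using (tri<; tri≈; tri>)
open import Relation.Binary.PropositionalEquality
  using (_≡_; _≢_; refl; sym; trans; cong; cong₂; subst; subst₂; setoid; module ≡-Reasoning)
open import Relation.Binary.Structures using (IsPartialOrder)
open import Relation.Nullary using (Dec; yes; no; ¬_; ¬?)
open import Relation.Nullary.Decidable using (_×-dec_)

module _ {A : Set} where

  private variable
    a b x y z : A
    xs ys : List A

  ∈-─⁺ : (p : x ∈ ys) → z ∈ ys → z ≢ x → z ∈ (ys ─ p)
  ∈-─⁺ (here refl) (here refl) z≢x = ⊥-elim (z≢x refl)
  ∈-─⁺ (here refl) (there q)   _   = q
  ∈-─⁺ (there p)   (here refl) _   = here refl
  ∈-─⁺ (there p)   (there q)   z≢x = there (∈-─⁺ p q z≢x)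

  Unique⇒∉-tail : Unique (x ∷ xs) → z ∈ xs → z ≢ x
  Unique⇒∉-tail u z∈xs refl = Uniqueₚ.Unique[x∷xs]⇒x∉xs u z∈xs

  Unique-⊆⇒length≤ : Unique xs → xs ⊆ ys → length xs ≤ length ys
  Unique-⊆⇒length≤ {[]}     _       _   = z≤n
  Unique-⊆⇒length≤ {x ∷ xs} {ys} u@(_ ∷ u′) sub
    rewrite Listₚ.length-removeAt′ ys (index (sub (here refl))) =
    s≤s (Unique-⊆⇒length≤ u′ λ z∈xs → ∈-─⁺ (sub (here refl)) (sub (there z∈xs)) (Unique⇒∉-tail u z∈xs))

  Unique-⊆⇒length< : Unique xs → xs ⊆ ys → y ∈ ys → y ∉ xs → length xs < length ys
  Unique-⊆⇒length< u sub y∈ys y∉xs =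
    Unique-⊆⇒length≤ (¬Any⇒All¬ _ y∉xs ∷ u) λ { (here refl) → y∈ys ; (there q) → sub q }

  ≡-dec-Unique : Unique xs → x ∈ xs → y ∈ xs → Dec (x ≡ y)
  ≡-dec-Unique u       (here refl) (here refl) = yes refl
  ≡-dec-Unique u       (here refl) (there q)   = no λ eq → Unique⇒∉-tail u q (sym eq)
  ≡-dec-Unique u       (there p)   (here refl) = no (Unique⇒∉-tail u p)
  ≡-dec-Unique (_ ∷ u) (there p)   (there q)   = ≡-dec-Unique u p q

  ∈-dec : (xs : List A) → (∀ {w} → w ∈ xs → Dec (z ≡ w)) → Dec (z ∈ xs)
  ∈-dec []       _  = no λ ()
  ∈-dec (w ∷ xs) z≟ with z≟ (here refl) | ∈-dec xs (λ w∈ → z≟ (there w∈))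
  ... | yes z≡w | _       = yes (here z≡w)
  ... | no _    | yes z∈  = yes (there z∈)
  ... | no z≢w  | no z∉   = no λ { (here z≡w) → z≢w z≡w ; (there z∈) → z∉ z∈ }

  Unique-⊆-length≥⇒⊇ : Unique xs → xs ⊆ ys → length ys ≤ length xs →
                       (∀ {u v} → u ∈ ys → v ∈ ys → Dec (u ≡ v)) → ys ⊆ xs
  Unique-⊆-length≥⇒⊇ {xs} u sub ys≤xs _≟_ z∈ys
    with ∈-dec xs (λ w∈xs → z∈ys ≟ sub w∈xs)
  ... | yes z∈xs = z∈xs
  ... | no z∉xs  = ⊥-elim (<⇒≱ (Unique-⊆⇒length< u sub z∈ys z∉xs) ys≤xs)

  ↭-Unique : Unique xs → Unique ys → (∀ {z} → z ∈ xs ⇔ z ∈ ys) → xs ↭ ys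
  ↭-Unique u₁ u₂ xs⇔ys = ∼bag⇒↭ (unique∧set⇒bag u₁ u₂ xs⇔ys)

  length-Unique : Unique xs → Unique ys → (∀ {z} → z ∈ xs ⇔ z ∈ ys) → length xs ≡ length ys
  length-Unique u₁ u₂ xs⇔ys = ↭-length (↭-Unique u₁ u₂ xs⇔ys)

  Unique-singleton : Unique xs → (∀ {z} → z ∈ xs ⇔ z ≡ a) → length xs ≡ 1
  Unique-singleton u xs⇔a = length-Unique u ([] ∷ [])
    (mk⇔ (λ z∈ → here (Equivalence.to xs⇔a z∈))
         (λ { (here z≡a) → Equivalence.from xs⇔a z≡a ; (there ()) }))

  length-∉-all : (∀ {z} → z ∉ xs) → length xs ≡ 0
  length-∉-all {[]}    _    = refl
  length-∉-all {x ∷ _} none = ⊥-elim (none (here refl))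

  ∈-pair : z ∈ a ∷ b ∷ [] → z ≡ a ⊎ z ≡ b
  ∈-pair (here z≡a)         = inj₁ z≡a
  ∈-pair (there (here z≡b)) = inj₂ z≡b

  ∈-length≡2 : length xs ≡ 2 → a ∈ xs → b ∈ xs → a ≢ b → z ∈ xs → z ≡ a ⊎ z ≡ b
  ∈-length≡2 {_ ∷ _ ∷ []} _ (here refl)         (here refl)         a≢b _  = ⊥-elim (a≢b refl)
  ∈-length≡2 {_ ∷ _ ∷ []} _ (here refl)         (there (here refl)) _   z∈ = ∈-pair z∈
  ∈-length≡2 {_ ∷ _ ∷ []} _ (there (here refl)) (here refl)         _   z∈ = Sum.swap (∈-pair z∈)
  ∈-length≡2 {_ ∷ _ ∷ []} _ (there (here refl)) (there (here refl)) a≢b _  = ⊥-elim (a≢b refl)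

  Unique-pair : Unique (a ∷ b ∷ []) → a ≢ b
  Unique-pair ((a≢b ∷ []) ∷ _) = a≢b

  length≡2⇒pair : length xs ≡ 2 → Unique xs →
                  Σ A λ a → Σ A λ b → a ≢ b × a ∈ xs × b ∈ xs × (∀ {z} → z ∈ xs → z ≡ a ⊎ z ≡ b)
  length≡2⇒pair {a ∷ b ∷ []} _ u = a , b , Unique-pair u , here refl , there (here refl) , ∈-pair

  other : length xs ≡ 2 → Unique xs → x ∈ xs →
          Σ A λ y → y ∈ xs × y ≢ x × (∀ {z} → z ∈ xs → z ≡ x ⊎ z ≡ y)
  other {a ∷ b ∷ []} _ u (here refl) =
    b , there (here refl) , (λ b≡a → Unique-pair u (sym b≡a)) , ∈-pair
  other {a ∷ b ∷ []} _ u (there (here refl)) =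
    a , here refl , Unique-pair u , λ z∈ → Sum.swap (∈-pair z∈)

  ∈-flattenPairs : ∀ {p} {ps : List (A × A)} → p ∈ ps → proj₁ p ∈ flattenPairs ps
  ∈-flattenPairs (here refl) = here refl
  ∈-flattenPairs (there p∈)  = there (there (∈-flattenPairs p∈))

  ∈-flattenPairs⇒nonempty : ∀ {ps : List (A × A)} → z ∈ flattenPairs ps → 1 ≤ length ps
  ∈-flattenPairs⇒nonempty {ps = _ ∷ _} _ = s≤s z≤n

  length-flattenPairs : (ps : List (A × A)) → length (flattenPairs ps) ≡ length ps + length ps
  length-flattenPairs []       = refl
  length-flattenPairs (p ∷ ps) = cong suc (trans (cong suc (length-flattenPairs ps)) (sym (+-suc _ _)))

module _ {A : Set} {Q : A → Set} where

  reject : (xs : List A) → (∀ {a} → a ∈ xs → Dec (Q a)) → List A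
  reject []       Q? = []
  reject (x ∷ xs) Q? with Q? (here refl)
  ... | yes _ = reject xs (Q? ∘′ there)
  ... | no  _ = x ∷ reject xs (Q? ∘′ there)

  ∈-reject⁻ : ∀ xs (Q? : ∀ {a} → a ∈ xs → Dec (Q a)) {a} → a ∈ reject xs Q? → a ∈ xs × ¬ Q a
  ∈-reject⁻ (x ∷ xs) Q? a∈ with Q? (here refl)
  ∈-reject⁻ (x ∷ xs) Q? a∈          | yes _ = let (a∈xs , ¬Qa) = ∈-reject⁻ xs (Q? ∘′ there) a∈ in there a∈xs , ¬Qa
  ∈-reject⁻ (x ∷ xs) Q? (here refl) | no ¬Qx = here refl , ¬Qx
  ∈-reject⁻ (x ∷ xs) Q? (there a∈)  | no _ = let (a∈xs , ¬Qa) = ∈-reject⁻ xs (Q? ∘′ there) a∈ in there a∈xs , ¬Qa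

  ∈-reject⁺ : ∀ xs (Q? : ∀ {a} → a ∈ xs → Dec (Q a)) {a} → a ∈ xs → ¬ Q a → a ∈ reject xs Q?
  ∈-reject⁺ (x ∷ xs) Q? a∈ ¬Qa with Q? (here refl)
  ∈-reject⁺ (x ∷ xs) Q? (here refl) ¬Qa | yes Qx = ⊥-elim (¬Qa Qx)
  ∈-reject⁺ (x ∷ xs) Q? (there a∈)  ¬Qa | yes _  = ∈-reject⁺ xs (Q? ∘′ there) a∈ ¬Qa
  ∈-reject⁺ (x ∷ xs) Q? (here refl) ¬Qa | no _   = here refl
  ∈-reject⁺ (x ∷ xs) Q? (there a∈)  ¬Qa | no _   = there (∈-reject⁺ xs (Q? ∘′ there) a∈ ¬Qa)

  reject-Unique : ∀ xs (Q? : ∀ {a} → a ∈ xs → Dec (Q a)) → Unique xs → Unique (reject xs Q?)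
  reject-Unique []       Q? _          = []
  reject-Unique (x ∷ xs) Q? (x∉ ∷ u) with Q? (here refl)
  ... | yes _ = reject-Unique xs (Q? ∘′ there) u
  ... | no  _ = L.tabulate (L.lookup x∉ ∘′ proj₁ ∘′ ∈-reject⁻ xs (Q? ∘′ there))
              ∷ reject-Unique xs (Q? ∘′ there) u

  reject-shorter : ∀ xs (Q? : ∀ {a} → a ∈ xs → Dec (Q a)) {a} → Unique xs → a ∈ xs → Q a →
                   length (reject xs Q?) < length xs
  reject-shorter xs Q? u a∈ Qa =
    Unique-⊆⇒length< (reject-Unique xs Q? u) (proj₁ ∘′ ∈-reject⁻ xs Q?) a∈ λ a∈r → proj₂ (∈-reject⁻ xs Q? a∈r) Qa

module _ {A : Set} (_~_ : A → A → Set) where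

  HasUniqueMate : List A → A → Set
  HasUniqueMate xs x = Σ A λ y → y ∈ xs × y ≢ x × x ~ y × (∀ {z} → z ∈ xs → x ~ z → z ≡ x ⊎ z ≡ y)

  PerfectMatching : List A → Set
  PerfectMatching xs = Σ (List (A × A)) λ ps →
    Unique (flattenPairs ps) × (∀ {z} → z ∈ xs ⇔ z ∈ flattenPairs ps) × L.All (λ p → proj₁ p ~ proj₂ p) ps

  length-PerfectMatching : ∀ {xs} → Unique xs → (M : PerfectMatching xs) →
                           length xs ≡ length (proj₁ M) + length (proj₁ M)
  length-PerfectMatching u (ps , ps-Unique , xs⇔ps , _) = trans (length-Unique u ps-Unique xs⇔ps) (length-flattenPairs ps)

module _ {A : Set} {_~_ : A → A → Set}
         (~-sym : ∀ {x y} → x ~ y → y ~ x) (~-trans : ∀ {x y z} → x ~ y → y ~ z → x ~ z) where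

  private
    matching′ : ∀ n xs → length xs ≤ n → Unique xs → (∀ {u v} → u ∈ xs → v ∈ xs → Dec (u ≡ v)) →
                (∀ {x} → x ∈ xs → HasUniqueMate _~_ xs x) → PerfectMatching _~_ xs
    matching′ _       []       _   _ _   _    = [] , [] , mk⇔ (λ ()) (λ ()) , []
    matching′ (suc n) (x ∷ xs) len u _≟_ mate with mate (here refl)
    ... | y , y∈ , y≢x , x~y , onlyMate =
      ((x , y) ∷ ps) , Unique-x∷y∷ps , mk⇔ to from , x~y ∷ ps~
      where
        xs₀ = x ∷ xs
        Q? : ∀ {z} → z ∈ xs₀ → Dec (z ≡ x ⊎ z ≡ y)
        Q? z∈ with z∈ ≟ here refl | z∈ ≟ y∈
        ... | yes z≡x | _       = yes (inj₁ z≡x)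
        ... | no _    | yes z≡y = yes (inj₂ z≡y)
        ... | no z≢x  | no z≢y  = no λ { (inj₁ z≡x) → z≢x z≡x ; (inj₂ z≡y) → z≢y z≡y }
        rest = reject xs₀ Q?
        rest⊆ : ∀ {z} → z ∈ rest → z ∈ xs₀
        rest⊆ = proj₁ ∘′ ∈-reject⁻ xs₀ Q?
        mate-of-rest : ∀ {w} → w ∈ rest → HasUniqueMate _~_ rest w
        mate-of-rest w∈ with ∈-reject⁻ xs₀ Q? w∈
        ... | w∈xs , w∉xy with mate w∈xs
        ...   | w′ , w′∈ , w′≢w , w~w′ , onlyMate′ =
          w′ , ∈-reject⁺ xs₀ Q? w′∈ w′∉xy , w′≢w , w~w′ , onlyMate′ ∘′ rest⊆
          where
            w′∉xy : ¬ (w′ ≡ x ⊎ w′ ≡ y)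
            w′∉xy (inj₁ refl) = w∉xy (onlyMate w∈xs (~-sym w~w′))
            w′∉xy (inj₂ refl) = w∉xy (onlyMate w∈xs (~-trans x~y (~-sym w~w′)))
        shorter : length rest ≤ n
        shorter = ≤-pred (≤-trans (reject-shorter xs₀ Q? u (here refl) (inj₁ refl)) len)
        recursive = matching′ n rest shorter (reject-Unique xs₀ Q? u)
                      (λ u∈ v∈ → rest⊆ u∈ ≟ rest⊆ v∈) mate-of-rest
        ps = proj₁ recursive
        ps-Unique = proj₁ (proj₂ recursive)
        rest⇔ps = proj₁ (proj₂ (proj₂ recursive))
        ps~ = proj₂ (proj₂ (proj₂ recursive))
        ∉ps : ∀ {z} → z ≡ x ⊎ z ≡ y → z ∉ flattenPairs ps
        ∉ps z∈xy z∈ps = proj₂ (∈-reject⁻ xs₀ Q? (Equivalence.from rest⇔ps z∈ps)) z∈xy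
        Unique-x∷y∷ps : Unique (x ∷ y ∷ flattenPairs ps)
        Unique-x∷y∷ps = ¬Any⇒All¬ _ (λ { (here x≡y) → y≢x (sym x≡y) ; (there x∈) → ∉ps (inj₁ refl) x∈ })
                      ∷ ¬Any⇒All¬ _ (∉ps (inj₂ refl)) ∷ ps-Unique
        to : ∀ {z} → z ∈ xs₀ → z ∈ x ∷ y ∷ flattenPairs ps
        to z∈ with Q? z∈
        ... | yes (inj₁ z≡x) = here z≡x
        ... | yes (inj₂ z≡y) = there (here z≡y)
        ... | no z∉xy        = there (there (Equivalence.to rest⇔ps (∈-reject⁺ xs₀ Q? z∈ z∉xy)))
        from : ∀ {z} → z ∈ x ∷ y ∷ flattenPairs ps → z ∈ xs₀
        from (here refl)         = here refl
        from (there (here refl)) = y∈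
        from (there (there z∈))  = rest⊆ (Equivalence.from rest⇔ps z∈)

  perfectMatching : ∀ xs → Unique xs → (∀ {u v} → u ∈ xs → v ∈ xs → Dec (u ≡ v)) →
                    (∀ {x} → x ∈ xs → HasUniqueMate _~_ xs x) → PerfectMatching _~_ xs
  perfectMatching xs = matching′ (length xs) xs ≤-refl

IsLeastPositive : (ℕ → Set) → ℕ → Set
IsLeastPositive P q = 1 ≤ q × P q × (∀ k → 1 ≤ k → k < q → ¬ P k)

module _ {P : ℕ → Set} (P? : ∀ n → Dec (P n)) where

  leastPositive : ∀ d → 1 ≤ d → P d → Σ ℕ (IsLeastPositive P)
  leastPositive = <-rec _ step
    where
      step : ∀ d → (∀ {k} → k < d → 1 ≤ k → P k → Σ ℕ (IsLeastPositive P)) → 1 ≤ d → P d → Σ ℕ (IsLeastPositive P)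
      step d smaller d≥1 Pd with anyUpTo? (λ k → (1 ≤? k) ×-dec P? k) d
      ... | yes (k , k<d , k≥1 , Pk) = smaller k<d k≥1 Pk
      ... | no none = d , d≥1 , Pd , λ k k≥1 k<d Pk → none (k , k<d , k≥1 , Pk)

module CommutativeMonoidSums {X : Set} {_⊕_ : X → X → X} {ε : X}
                             (isCM : IsCommutativeMonoid _≡_ _⊕_ ε) where
  open IsCommutativeMonoid isCM using (assoc; identityˡ; comm)
  open ≡-Reasoning

  ∑ : List X → X
  ∑ = foldr _⊕_ ε

  private
    ⊕-swap-left : ∀ a b c → a ⊕ (b ⊕ c) ≡ b ⊕ (a ⊕ c)
    ⊕-swap-left a b c = trans (sym (assoc a b c)) (trans (cong (_⊕ c) (comm a b)) (assoc b a c))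

  module _ {A : Set} where

    ∑-map-cong : (xs : List A) {f g : A → X} → (∀ {z} → z ∈ xs → f z ≡ g z) →
                 ∑ (map f xs) ≡ ∑ (map g xs)
    ∑-map-cong []       _   = refl
    ∑-map-cong (x ∷ xs) f≗g = cong₂ _⊕_ (f≗g (here refl)) (∑-map-cong xs (f≗g ∘′ there))

    ∑-map-Unique : {xs ys : List A} (f : A → X) → Unique xs → Unique ys →
                   (∀ {z} → z ∈ xs ⇔ z ∈ ys) → ∑ (map f xs) ≡ ∑ (map f ys)
    ∑-map-Unique f u₁ u₂ xs⇔ys =
      Permutationₛ.foldr-commMonoid (setoid X) isCM (↭⇒↭ₛ (map⁺ f (↭-Unique u₁ u₂ xs⇔ys)))

    ∑-map-++ : (xs ys : List A) (f : A → X) → ∑ (map f (xs ++ ys)) ≡ ∑ (map f xs) ⊕ ∑ (map f ys)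
    ∑-map-++ []       ys f = sym (identityˡ _)
    ∑-map-++ (x ∷ xs) ys f = trans (cong (f x ⊕_) (∑-map-++ xs ys f)) (sym (assoc (f x) _ _))

    ∑-map-⊕ : (xs : List A) (f g : A → X) →
              ∑ (map (λ a → f a ⊕ g a) xs) ≡ ∑ (map f xs) ⊕ ∑ (map g xs)
    ∑-map-⊕ []       f g = sym (identityˡ ε)
    ∑-map-⊕ (x ∷ xs) f g = begin
      (f x ⊕ g x) ⊕ ∑ (map (λ a → f a ⊕ g a) xs) ≡⟨ cong ((f x ⊕ g x) ⊕_) (∑-map-⊕ xs f g) ⟩
      (f x ⊕ g x) ⊕ (∑ (map f xs) ⊕ ∑ (map g xs)) ≡⟨ assoc (f x) (g x) _ ⟩
      f x ⊕ (g x ⊕ (∑ (map f xs) ⊕ ∑ (map g xs))) ≡⟨ cong (f x ⊕_) (⊕-swap-left (g x) _ _) ⟩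
      f x ⊕ (∑ (map f xs) ⊕ (g x ⊕ ∑ (map g xs))) ≡⟨ sym (assoc (f x) _ _) ⟩
      (f x ⊕ ∑ (map f xs)) ⊕ (g x ⊕ ∑ (map g xs)) ∎

    ∑-filter-split : {Q : A → Set} (Q? : ∀ a → Dec (Q a)) (f : A → X) (xs : List A) →
      ∑ (map f xs) ≡ ∑ (map f (filter Q? xs)) ⊕ ∑ (map f (filter (λ a → ¬? (Q? a)) xs))
    ∑-filter-split Q? f [] = sym (identityˡ _)
    ∑-filter-split Q? f (x ∷ xs) with Q? x
    ... | yes _ = trans (cong (f x ⊕_) (∑-filter-split Q? f xs)) (sym (assoc (f x) _ _))
    ... | no _  = trans (cong (f x ⊕_) (∑-filter-split Q? f xs)) (⊕-swap-left (f x) _ _)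

  module _ {A B : Set} where

    pairs : List A → (A → List B) → List (A × B)
    pairs []       F = []
    pairs (a ∷ as) F = map (a ,_) (F a) ++ pairs as F

    private
      ∑-map-map : ∀ {C : Set} (xs : List C) (h : C → A × B) (g : A × B → X) →
                  ∑ (map g (map h xs)) ≡ ∑ (map (λ c → g (h c)) xs)
      ∑-map-map []       h g = refl
      ∑-map-map (x ∷ xs) h g = cong (g (h x) ⊕_) (∑-map-map xs h g)

    ∑-pairs : (as : List A) (F : A → List B) (g : A → B → X) →
              ∑ (map (λ a → ∑ (map (g a) (F a))) as) ≡ ∑ (map (λ p → g (proj₁ p) (proj₂ p)) (pairs as F))
    ∑-pairs []       F g = refl
    ∑-pairs (a ∷ as) F g = trans
      (cong₂ _⊕_ (sym (∑-map-map (F a) (a ,_) (λ p → g (proj₁ p) (proj₂ p)))) (∑-pairs as F g))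
      (sym (∑-map-++ (map (a ,_) (F a)) (pairs as F) (λ p → g (proj₁ p) (proj₂ p))))

    ∈-pairs⁺ : ∀ {as F a b} → a ∈ as → b ∈ F a → (a , b) ∈ pairs as F
    ∈-pairs⁺ {a ∷ as} {F} (here refl)  b∈ = ∈-++⁺ˡ (∈-map⁺ (a ,_) b∈)
    ∈-pairs⁺ {a ∷ as} {F} (there a∈) b∈ = ∈-++⁺ʳ (map (a ,_) (F a)) (∈-pairs⁺ a∈ b∈)

    ∈-pairs⁻ : ∀ as {F a b} → (a , b) ∈ pairs as F → a ∈ as × b ∈ F a
    ∈-pairs⁻ (a ∷ as) {F} p∈ with ∈-++⁻ (map (a ,_) (F a)) p∈
    ... | inj₁ q with ∈-map⁻ (a ,_) q
    ...   | _ , b∈ , refl = here refl , b∈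
    ∈-pairs⁻ (a ∷ as) {F} p∈ | inj₂ q with ∈-pairs⁻ as q
    ...   | a∈ , b∈ = there a∈ , b∈

    pairs-Unique : ∀ {as F} → Unique as → (∀ a → Unique (F a)) → Unique (pairs as F)
    pairs-Unique {[]}     _         _  = []
    pairs-Unique {a ∷ as} {F} (a∉ ∷ u) uF =
      Uniqueₚ.++⁺ (Uniqueₚ.map⁺ (cong proj₂) (uF a)) (pairs-Unique u uF) disjoint
      where
        disjoint : Disjoint (map (a ,_) (F a)) (pairs as F)
        disjoint (p₁ , p₂) with ∈-map⁻ (a ,_) p₁
        ... | _ , _ , refl = Unique⇒∉-tail (a∉ ∷ u) (proj₁ (∈-pairs⁻ as p₂)) refl

  -- Fubini: both sides sum g over the same set of pairs (a , c).
  ∑-swap : ∀ {A B : Set} (as : List A) (F : A → List B) (cs : List B) (G : B → List A) (g : A → B → X) →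
    Unique as → (∀ a → Unique (F a)) → Unique cs → (∀ c → Unique (G c)) →
    (∀ a c → (a ∈ as × c ∈ F a) ⇔ (c ∈ cs × a ∈ G c)) →
    ∑ (map (λ a → ∑ (map (g a) (F a))) as) ≡ ∑ (map (λ c → ∑ (map (λ a → g a c) (G c))) cs)
  ∑-swap {A} {B} as F cs G g uA uF uC uG ⇔ = begin
    ∑ (map (λ a → ∑ (map (g a) (F a))) as)           ≡⟨ ∑-pairs as F g ⟩
    ∑ (map h (pairs as F))                             ≡⟨ ∑-map-Unique h (pairs-Unique uA uF) swapped-Unique (mk⇔ to from) ⟩
    ∑ (map h (map swap (pairs cs G)))                  ≡⟨ ∑-map-swap (pairs cs G) ⟩
    ∑ (map (λ p → g (proj₂ p) (proj₁ p)) (pairs cs G)) ≡⟨ sym (∑-pairs cs G (λ c a → g a c)) ⟩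
    ∑ (map (λ c → ∑ (map (λ a → g a c) (G c))) cs)   ∎
    where
      h : A × B → X
      h p = g (proj₁ p) (proj₂ p)
      ∑-map-swap : ∀ (ps : List (B × A)) → ∑ (map h (map swap ps)) ≡ ∑ (map (λ p → g (proj₂ p) (proj₁ p)) ps)
      ∑-map-swap []       = refl
      ∑-map-swap (p ∷ ps) = cong (h (swap p) ⊕_) (∑-map-swap ps)
      swap-injective : ∀ {p q : B × A} → swap p ≡ swap q → p ≡ q
      swap-injective {_ , _} {_ , _} refl = refl
      swapped-Unique : Unique (map swap (pairs cs G))
      swapped-Unique = Uniqueₚ.map⁺ swap-injective (pairs-Unique uC uG)
      to : ∀ {p} → p ∈ pairs as F → p ∈ map swap (pairs cs G)
      to {a , c} p∈ = let (c∈ , a∈) = Equivalence.to (⇔ a c) (∈-pairs⁻ as p∈) in ∈-map⁺ swap (∈-pairs⁺ c∈ a∈)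
      from : ∀ {p} → p ∈ map swap (pairs cs G) → p ∈ pairs as F
      from p∈ with ∈-map⁻ swap p∈
      ... | (c , a) , q∈ , refl = let (a∈ , c∈) = Equivalence.from (⇔ a c) (∈-pairs⁻ cs q∈) in ∈-pairs⁺ a∈ c∈

module ℕ-Sums = CommutativeMonoidSums +-0-isCommutativeMonoid

∑-const : ∀ {A : Set} (xs : List A) {f : A → ℕ} {k} → (∀ {z} → z ∈ xs → f z ≡ k) → sum (map f xs) ≡ length xs * k
∑-const []       _      = refl
∑-const (x ∷ xs) f≡k = cong₂ _+_ (f≡k (here refl)) (∑-const xs (λ z∈ → f≡k (there z∈)))

≤-∑ : ∀ {A : Set} (xs : List A) (f : A → ℕ) {z} → z ∈ xs → f z ≤ sum (map f xs)
≤-∑ (x ∷ xs) f (here refl) = m≤m+n (f x) _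
≤-∑ (x ∷ xs) f (there z∈) = ≤-trans (≤-∑ xs f z∈) (m≤n+m _ (f x))

module GradedPosetProperties (P : GradedPoset) where
  open GradedPoset P public
  open IsPartialOrder isPartialOrder public
    using (antisym) renaming (trans to ≼-trans; refl to ≼-refl)

  private variable
    u v w x y z : Carrier

  ∈-interval⁺ : x ≼ z → z ≼ y → z ∈ interval x y
  ∈-interval⁺ {x} {z} {y} x≼z z≼y = Equivalence.from (interval-spec x y z) (x≼z , z≼y)

  ∈-interval⁻ : z ∈ interval x y → x ≼ z × z ≼ y
  ∈-interval⁻ {z} {x} {y} = Equivalence.to (interval-spec x y z)

  ≡-dec-in : x ≼ u → u ≼ y → x ≼ v → v ≼ y → Dec (u ≡ v)
  ≡-dec-in {x} {u} {y} x≼u u≼y x≼v v≼y =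
    ≡-dec-Unique (interval-unique x y) (∈-interval⁺ x≼u u≼y) (∈-interval⁺ x≼v v≼y)

  ≡-dec-below : u ≼ y → v ≼ y → Dec (u ≡ v)
  ≡-dec-below {u} {_} {v} u≼y v≼y = ≡-dec-in (0̂-min u) u≼y (0̂-min v) v≼y

  private
    ilen : Carrier → Carrier → ℕ
    ilen u v = length (interval u v)

    middle-in : u ≼ v → (xs : List Carrier) → (∀ {w} → w ∈ xs → w ∈ interval u v) →
                (Σ Carrier λ w → u ≼ w × w ≼ v × w ≢ u × w ≢ v) ⊎ (∀ {w} → w ∈ xs → w ≡ u ⊎ w ≡ v)
    middle-in u≼v []       _   = inj₂ λ ()
    middle-in {u} {v} u≼v (w ∷ xs) sub with middle-in u≼v xs (sub ∘ there)
    ... | inj₁ found = inj₁ found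
    ... | inj₂ ends with ∈-interval⁻ (sub (here refl))
    ...   | u≼w , w≼v with ≡-dec-in u≼w w≼v ≼-refl u≼v | ≡-dec-in u≼w w≼v u≼v ≼-refl
    ...     | yes w≡u | _       = inj₂ λ { (here refl) → inj₁ w≡u ; (there q) → ends q }
    ...     | no _    | yes w≡v = inj₂ λ { (here refl) → inj₂ w≡v ; (there q) → ends q }
    ...     | no w≢u  | no w≢v  = inj₁ (w , u≼w , w≼v , w≢u , w≢v)

    middle? : u ≼ v → (Σ Carrier λ w → u ≼ w × w ≼ v × w ≢ u × w ≢ v) ⊎ (∀ w → u ≼ w → w ≼ v → w ≡ u ⊎ w ≡ v)
    middle? u≼v with middle-in u≼v _ (λ w∈ → w∈)
    ... | inj₁ found = inj₁ found
    ... | inj₂ ends  = inj₂ λ w u≼w w≼v → ends (∈-interval⁺ u≼w w≼v)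

    ilen-shrinkʳ : u ≼ w → w ≼ v → w ≢ v → ilen u w < ilen u v
    ilen-shrinkʳ u≼w w≼v w≢v =
      Unique-⊆⇒length< (interval-unique _ _)
        (λ z∈ → let (u≼z , z≼w) = ∈-interval⁻ z∈ in ∈-interval⁺ u≼z (≼-trans z≼w w≼v))
        (∈-interval⁺ (≼-trans u≼w w≼v) ≼-refl) (λ v∈ → w≢v (antisym w≼v (proj₂ (∈-interval⁻ v∈))))

    ilen-shrinkˡ : u ≼ w → w ≼ v → w ≢ u → ilen w v < ilen u v
    ilen-shrinkˡ u≼w w≼v w≢u =
      Unique-⊆⇒length< (interval-unique _ _)
        (λ z∈ → let (w≼z , z≼v) = ∈-interval⁻ z∈ in ∈-interval⁺ (≼-trans u≼w w≼z) z≼v)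
        (∈-interval⁺ ≼-refl (≼-trans u≼w w≼v)) (λ u∈ → w≢u (antisym (proj₁ (∈-interval⁻ u∈)) u≼w))

    cover-above′ : ∀ n → ilen u v < n → u ≼ v → u ≢ v → Σ Carrier λ w → u ⋖ w × w ≼ v
    cover-above′ (suc n) lt u≼v u≢v with middle? u≼v
    ... | inj₂ ends = _ , ((u≼v , u≢v) , ends) , ≼-refl
    ... | inj₁ (w , u≼w , w≼v , w≢u , w≢v) =
      let (w′ , u⋖w′ , w′≼w) = cover-above′ n (≤-trans (ilen-shrinkʳ u≼w w≼v w≢v) (≤-pred lt)) u≼w (w≢u ∘ sym)
      in w′ , u⋖w′ , ≼-trans w′≼w w≼v

    cover-below′ : ∀ n → ilen u v < n → u ≼ v → u ≢ v → Σ Carrier λ w → u ≼ w × w ⋖ v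
    cover-below′ (suc n) lt u≼v u≢v with middle? u≼v
    ... | inj₂ ends = _ , ≼-refl , ((u≼v , u≢v) , ends)
    ... | inj₁ (w , u≼w , w≼v , w≢u , w≢v) =
      let (w′ , w≼w′ , w′⋖v) = cover-below′ n (≤-trans (ilen-shrinkˡ u≼w w≼v w≢u) (≤-pred lt)) w≼v w≢v
      in w′ , ≼-trans u≼w w≼w′ , w′⋖v

  cover-above : u ≼ v → u ≢ v → Σ Carrier λ w → u ⋖ w × w ≼ v
  cover-above = cover-above′ _ ≤-refl

  cover-below : u ≼ v → u ≢ v → Σ Carrier λ w → u ≼ w × w ⋖ v
  cover-below = cover-below′ _ ≤-refl

  ⋖⇒ρ≡suc : u ⋖ v → ρ v ≡ suc (ρ u)
  ⋖⇒ρ≡suc {u} {v} ((u≼v , u≢v) , ends) = ρ-cover u v u≼v u≢v ends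

  ⋖⇒≼ : u ⋖ v → u ≼ v
  ⋖⇒≼ = proj₁ ∘ proj₁

  private
    ρ-strict′ : ∀ n → ilen u v < n → u ≼ v → u ≢ v → ρ u < ρ v
    ρ-strict′ (suc n) lt u≼v u≢v with middle? u≼v
    ... | inj₂ ends = ≤-reflexive (sym (ρ-cover _ _ u≼v u≢v ends))
    ... | inj₁ (w , u≼w , w≼v , w≢u , w≢v) =
      <-trans (ρ-strict′ n (≤-trans (ilen-shrinkʳ u≼w w≼v w≢v) (≤-pred lt)) u≼w (w≢u ∘ sym))
              (ρ-strict′ n (≤-trans (ilen-shrinkˡ u≼w w≼v w≢u) (≤-pred lt)) w≼v w≢v)

  ρ-strict : u ≼ v → u ≢ v → ρ u < ρ v
  ρ-strict = ρ-strict′ _ ≤-refl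

  ρ-mono : u ≼ v → ρ u ≤ ρ v
  ρ-mono u≼v with ≡-dec-in ≼-refl u≼v u≼v ≼-refl
  ... | yes refl = ≤-refl
  ... | no u≢v   = <⇒≤ (ρ-strict u≼v u≢v)

  ≼∧ρ≡⇒≡ : u ≼ v → ρ u ≡ ρ v → u ≡ v
  ≼∧ρ≡⇒≡ u≼v ρu≡ρv with ≡-dec-in ≼-refl u≼v u≼v ≼-refl
  ... | yes u≡v = u≡v
  ... | no u≢v  = ⊥-elim (<-irrefl ρu≡ρv (ρ-strict u≼v u≢v))

  ≼∧ρ≡suc⇒⋖ : u ≼ v → ρ v ≡ suc (ρ u) → u ⋖ v
  ≼∧ρ≡suc⇒⋖ {u} {v} u≼v ρv≡ = (u≼v , λ u≡v → 1+n≢n (trans (sym ρv≡) (cong ρ (sym u≡v)))) , ends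
    where
      ends : ∀ w → u ≼ w → w ≼ v → w ≡ u ⊎ w ≡ v
      ends w u≼w w≼v with ≡-dec-in u≼w w≼v ≼-refl u≼v | ≡-dec-in u≼w w≼v u≼v ≼-refl
      ... | yes w≡u | _       = inj₁ w≡u
      ... | no _    | yes w≡v = inj₂ w≡v
      ... | no w≢u  | no w≢v  = ⊥-elim (<⇒≱ (ρ-strict u≼w (λ u≡w → w≢u (sym u≡w)))
                                   (≤-pred (subst (suc (ρ w) ≤_) ρv≡ (ρ-strict w≼v w≢v))))

  ρ≡0⇒≡0̂ : ρ z ≡ 0 → z ≡ 0̂
  ρ≡0⇒≡0̂ {z} ρz≡0 = sym (≼∧ρ≡⇒≡ (0̂-min z) (trans ρ-0̂ (sym ρz≡0)))

  ρ≢0⇒≢0̂ : ρ z ≢ 0 → z ≢ 0̂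
  ρ≢0⇒≢0̂ ρz≢0 refl = ρz≢0 ρ-0̂

  level : Carrier → Carrier → ℕ → List Carrier
  level x y k = filter (λ z → ρ z ≟ k) (interval x y)

  level-Unique : ∀ x y k → Unique (level x y k)
  level-Unique x y k = Uniqueₚ.filter⁺ (λ z → ρ z ≟ k) (interval-unique x y)

  ∈-level⁺ : ∀ {k} → x ≼ z → z ≼ y → ρ z ≡ k → z ∈ level x y k
  ∈-level⁺ {k = k} x≼z z≼y ρz≡k = ∈-filter⁺ (λ z → ρ z ≟ k) (∈-interval⁺ x≼z z≼y) ρz≡k

  ∈-level⁻ : ∀ {k} → z ∈ level x y k → x ≼ z × z ≼ y × ρ z ≡ k
  ∈-level⁻ {k = k} z∈ = let (z∈I , ρz≡k) = ∈-filter⁻ (λ z → ρ z ≟ k) z∈ ; (x≼z , z≼y) = ∈-interval⁻ z∈I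
                         in x≼z , z≼y , ρz≡k

  level-top : ∀ {k} → x ≼ y → ρ y ≡ k → z ∈ level x y k ⇔ z ≡ y
  level-top x≼y refl = mk⇔ (λ z∈ → let (_ , z≼y , ρz≡) = ∈-level⁻ z∈ in ≼∧ρ≡⇒≡ z≼y ρz≡)
                           (λ { refl → ∈-level⁺ x≼y ≼-refl refl })

  level-bottom : ∀ {k} → x ≼ y → ρ x ≡ k → z ∈ level x y k ⇔ z ≡ x
  level-bottom x≼y refl = mk⇔ (λ z∈ → let (x≼z , _ , ρz≡) = ∈-level⁻ z∈ in sym (≼∧ρ≡⇒≡ x≼z (sym ρz≡)))
                              (λ { refl → ∈-level⁺ ≼-refl x≼y refl })

  length-level-top : ∀ {k} → x ≼ y → ρ y ≡ k → length (level x y k) ≡ 1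
  length-level-top x≼y ρy≡k = Unique-singleton (level-Unique _ _ _) (level-top x≼y ρy≡k)

  length-level-bottom : ∀ {k} → x ≼ y → ρ x ≡ k → length (level x y k) ≡ 1
  length-level-bottom x≼y ρx≡k = Unique-singleton (level-Unique _ _ _) (level-bottom x≼y ρx≡k)

module ChainCounting (P : GradedPoset) where
  open GradedPosetProperties P

  -- A maximal chain of [x,y] is a maximal chain of [x,c] for a coatom c, followed by c ⋖ y.
  chains-via-coatoms : ∀ n x y → x ≼ y → ρ y ≡ ρ x + suc n →
    chainsFuel (suc n) x y ≡ sum (map (chainsFuel n x) (level x y (ρ x + n)))
  chains-via-coatoms zero x y x≼y ρy≡ = begin
    sum (map (λ _ → 1) (level x y (suc (ρ x)))) ≡⟨ ∑-const (level x y _) (λ _ → refl) ⟩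
    length (level x y (suc (ρ x))) * 1           ≡⟨ cong (_* 1) (trans (length-level-top x≼y (trans ρy≡ (+-comm (ρ x) 1)))
                                                      (sym (length-level-bottom x≼y (sym (+-identityʳ (ρ x)))))) ⟩
    length (level x y (ρ x + 0)) * 1             ≡⟨ sym (∑-const (level x y _) (λ _ → refl)) ⟩
    sum (map (λ _ → 1) (level x y (ρ x + 0)))   ∎
    where open ≡-Reasoning
  chains-via-coatoms (suc n) x y x≼y ρy≡ = begin
    sum (map (λ a → chainsFuel (suc n) a y) atoms)
      ≡⟨ ℕ-Sums.∑-map-cong atoms (λ a∈ → let (_ , a≼y , ρa≡) = ∈-level⁻ a∈ in
                                     chains-via-coatoms n _ y a≼y (ρ-above ρa≡)) ⟩
    sum (map (λ a → sum (map (chainsFuel n a) (level a y (ρ a + n)))) atoms)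
      ≡⟨ ℕ-Sums.∑-swap atoms (λ a → level a y (ρ a + n)) coatoms (λ c → level x c (suc (ρ x))) (λ a c → chainsFuel n a c)
           (level-Unique _ _ _) (λ _ → level-Unique _ _ _) (level-Unique _ _ _) (λ _ → level-Unique _ _ _) flags⇔ ⟩
    sum (map (chainsFuel (suc n) x) coatoms) ∎
    where
      open ≡-Reasoning
      atoms = level x y (suc (ρ x))
      coatoms = level x y (ρ x + suc n)
      ρ-above : ∀ {a} → ρ a ≡ suc (ρ x) → ρ y ≡ ρ a + suc n
      ρ-above ρa≡ = trans ρy≡ (trans (+-suc (ρ x) (suc n)) (cong (_+ suc n) (sym ρa≡)))
      flags⇔ : ∀ a c → (a ∈ atoms × c ∈ level a y (ρ a + n)) ⇔ (c ∈ coatoms × a ∈ level x c (suc (ρ x)))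
      flags⇔ a c = mk⇔
        (λ (a∈ , c∈) → let (x≼a , a≼y , ρa≡) = ∈-level⁻ a∈ ; (a≼c , c≼y , ρc≡) = ∈-level⁻ c∈ in
           ∈-level⁺ (≼-trans x≼a a≼c) c≼y (trans ρc≡ (trans (cong (_+ n) ρa≡) (sym (+-suc (ρ x) n)))) ,
           ∈-level⁺ x≼a a≼c ρa≡)
        (λ (c∈ , a∈) → let (x≼c , c≼y , ρc≡) = ∈-level⁻ c∈ ; (x≼a , a≼c , ρa≡) = ∈-level⁻ a∈ in
           ∈-level⁺ x≼a (≼-trans a≼c c≼y) ρa≡ ,
           ∈-level⁺ a≼c c≼y (trans ρc≡ (trans (+-suc (ρ x) n) (cong (_+ n) (sym ρa≡)))))

  chains-positive : ∀ n x y → x ≼ y → ρ y ≡ ρ x + n → 1 ≤ chainsFuel n x y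
  chains-positive zero    x y x≼y ρy≡ = ≤-refl
  chains-positive (suc n) x y x≼y ρy≡
    with cover-above x≼y (λ x≡y → m≢1+n+m (ρ x) (trans (cong ρ x≡y) (trans ρy≡ (+-comm (ρ x) (suc n)))))
  ... | a , x⋖a , a≼y =
    ≤-trans (chains-positive n a y a≼y (trans ρy≡ (trans (+-suc (ρ x) n) (cong (_+ n) (sym (⋖⇒ρ≡suc x⋖a))))))
            (≤-∑ (level x y (suc (ρ x))) (λ z → chainsFuel n z y) (∈-level⁺ (⋖⇒≼ x⋖a) a≼y (⋖⇒ρ≡suc x⋖a)))

  maxChains≡chainsFuel : ∀ {x y} k → ρ y ≡ ρ x + k → maxChains x y ≡ chainsFuel k x y
  maxChains≡chainsFuel {x} {y} k ρy≡ = cong (λ t → chainsFuel t x y) (trans (cong (_∸ ρ x) ρy≡) (m+n∸m≡n (ρ x) k))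

module ShefferProperties (P : GradedPoset) (S : IsSheffer P) where
  open GradedPosetProperties P
  open ChainCounting P
  open IsSheffer S

  rank-unbounded : ∀ N → Σ Carrier λ y → N ≤ ρ y
  rank-unbounded N with Finₚ.any? {n = suc N} (λ i → N ≤? ρ (chainSeq (toℕ i)))
  ... | yes (i , N≤) = chainSeq (toℕ i) , N≤
  ... | no none = ⊥-elim contradiction
    where
      -- two of N + 1 chain elements of rank < N share a rank, and comparable elements of equal rank coincide
      below : ∀ i → ρ (chainSeq (toℕ i)) < N
      below i = ≰⇒> (λ N≤ → none (i , N≤))
      contradiction : ⊥
      contradiction with Finₚ.pigeonhole (n<1+n N) (λ i → fromℕ< (below i))
      ... | i , j , i<j , same =
        let ρ≡ = trans (sym (Finₚ.toℕ-fromℕ< (below i))) (trans (cong toℕ same) (Finₚ.toℕ-fromℕ< (below j)))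
            chain≡ = [ (λ i≼j → ≼∧ρ≡⇒≡ i≼j ρ≡) , (λ j≼i → sym (≼∧ρ≡⇒≡ j≼i (sym ρ≡))) ]
                       (chain-comparable (toℕ i) (toℕ j))
        in <-irrefl (chain-injective _ _ chain≡) i<j

  private
    rank-below′ : ∀ d k y → ρ y ≡ d + k → Σ Carrier λ z → z ≼ y × ρ z ≡ k
    rank-below′ zero    k y ρy≡ = y , ≼-refl , ρy≡
    rank-below′ (suc d) k y ρy≡
      with cover-below (0̂-min y) (λ 0̂≡y → 1+n≢0 (trans (sym ρy≡) (trans (cong ρ (sym 0̂≡y)) ρ-0̂)))
    ... | w , _ , w⋖y =
      let (z , z≼w , ρz≡k) = rank-below′ d k w (suc-injective (trans (sym (⋖⇒ρ≡suc w⋖y)) ρy≡))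
      in z , ≼-trans z≼w (⋖⇒≼ w⋖y) , ρz≡k

  rank-below : ∀ k y → k ≤ ρ y → Σ Carrier λ z → z ≼ y × ρ z ≡ k
  rank-below k y k≤ = rank-below′ (ρ y ∸ k) k y (sym (m∸n+n≡m k≤))

  element-of-rank : ∀ n → Σ Carrier λ y → ρ y ≡ n
  element-of-rank n = let (y , n≤) = rank-unbounded n ; (z , _ , ρz≡n) = rank-below n y n≤ in z , ρz≡n

  private
    maxChains-Sheffer : ∀ {y} k → ρ y ≡ suc k → chainsFuel (suc k) 0̂ y ≡ D (suc k)
    maxChains-Sheffer {y} k ρy≡ =
      trans (sym (maxChains≡chainsFuel (suc k) (trans ρy≡ (cong (_+ suc k) (sym ρ-0̂)))))
            (trans (D-spec y (ρ≢0⇒≢0̂ (λ ρy≡0 → 1+n≢0 (trans (sym ρy≡) ρy≡0)))) (cong D ρy≡))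

    D-positive : ∀ n → 1 ≤ D (suc n)
    D-positive n = let (y , ρy≡) = element-of-rank (suc n) in
      subst (1 ≤_) (maxChains-Sheffer n ρy≡)
            (chains-positive (suc n) 0̂ y (0̂-min y) (trans ρy≡ (cong (_+ suc n) (sym ρ-0̂))))

    D-via-coatoms : ∀ n y → ρ y ≡ suc (suc n) → D (suc (suc n)) ≡ length (level 0̂ y (suc n)) * D (suc n)
    D-via-coatoms n y ρy≡ = begin
      D (suc (suc n))                                            ≡⟨ sym (maxChains-Sheffer (suc n) ρy≡) ⟩
      chainsFuel (suc (suc n)) 0̂ y                               ≡⟨ chains-via-coatoms (suc n) 0̂ y (0̂-min y) ρy≡′ ⟩
      sum (map (chainsFuel (suc n) 0̂) (level 0̂ y (ρ 0̂ + suc n))) ≡⟨ ∑-const (level 0̂ y _) coatom-chains ⟩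
      length (level 0̂ y (ρ 0̂ + suc n)) * D (suc n)             ≡⟨ cong (λ k → length (level 0̂ y (k + suc n)) * D (suc n)) ρ-0̂ ⟩
      length (level 0̂ y (suc n)) * D (suc n)                    ∎
      where
        open ≡-Reasoning
        ρy≡′ = trans ρy≡ (cong (_+ suc (suc n)) (sym ρ-0̂))
        coatom-chains : ∀ {c} → c ∈ level 0̂ y (ρ 0̂ + suc n) → chainsFuel (suc n) 0̂ c ≡ D (suc n)
        coatom-chains c∈ = maxChains-Sheffer n (trans (proj₂ (proj₂ (∈-level⁻ c∈))) (cong (_+ suc n) ρ-0̂))

    C-unfold : ∀ n k → D n ≡ suc k → C (suc n) ≡ D (suc n) / suc k
    C-unfold n k D≡ rewrite D≡ = refl

    C≡#coatoms′ : ∀ n y k → D (suc n) ≡ suc k → ρ y ≡ suc (suc n) → C (suc (suc n)) ≡ length (level 0̂ y (suc n))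
    C≡#coatoms′ n y k D≡ ρy≡ = trans (C-unfold (suc n) k D≡)
      (trans (cong (_/ suc k) (trans (D-via-coatoms n y ρy≡) (cong (length (level 0̂ y (suc n)) *_) D≡)))
             (m*n/n≡m (length (level 0̂ y (suc n))) (suc k)))

  C≡#coatoms : ∀ n y → ρ y ≡ suc (suc n) → C (suc (suc n)) ≡ length (level 0̂ y (suc n))
  C≡#coatoms n y ρy≡ = let (k , 1+k≡D) = m≤n⇒∃[o]m+o≡n (D-positive n) in C≡#coatoms′ n y k (sym 1+k≡D) ρy≡

module TwoPowBinomial (P : GradedPoset) (S : IsSheffer P) (B≡ : ∀ n → IsSheffer.B S n ≡ twoPowPred n) where
  open GradedPosetProperties P
  open ChainCounting P
  open IsSheffer S

  chains≡twoPowPred : ∀ {x y} k → x ≢ 0̂ → x ≼ y → ρ y ≡ ρ x + k → chainsFuel k x y ≡ twoPowPred k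
  chains≡twoPowPred {x} {y} k x≢0̂ x≼y ρy≡ =
    trans (sym (maxChains≡chainsFuel k ρy≡))
          (trans (B-spec x y x≢0̂ x≼y) (trans (cong B (trans (cong (_∸ ρ x) ρy≡) (m+n∸m≡n (ρ x) k))) (B≡ k)))

  private
    count≡2 : ∀ n L → L * 2 ^ n ≡ 2 * 2 ^ n → L ≡ 2
    count≡2 n L eq = *-cancelʳ-≡ L 2 (2 ^ n) {{m^n≢0 2 n}} eq

  -- Each atom (coatom) of a non-Sheffer n-interval carries 2^(n-2) of its 2^(n-1) maximal chains.
  #atoms≡2 : ∀ n {x y} → x ≢ 0̂ → x ≼ y → ρ y ≡ ρ x + suc (suc n) → length (level x y (suc (ρ x))) ≡ 2
  #atoms≡2 n {x} {y} x≢0̂ x≼y ρy≡ =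
    count≡2 n _ (trans (sym (∑-const (level x y (suc (ρ x))) atom-chains)) (chains≡twoPowPred (suc (suc n)) x≢0̂ x≼y ρy≡))
    where
      atom-chains : ∀ {a} → a ∈ level x y (suc (ρ x)) → chainsFuel (suc n) a y ≡ 2 ^ n
      atom-chains a∈ = let (_ , a≼y , ρa≡) = ∈-level⁻ a∈ in
        chains≡twoPowPred (suc n) (ρ≢0⇒≢0̂ (λ ρa≡0 → 1+n≢0 (trans (sym ρa≡) ρa≡0))) a≼y
          (trans ρy≡ (trans (+-suc (ρ x) (suc n)) (cong (_+ suc n) (sym ρa≡))))

  #coatoms≡2 : ∀ n {x y} → x ≢ 0̂ → x ≼ y → ρ y ≡ ρ x + suc (suc n) → length (level x y (ρ x + suc n)) ≡ 2
  #coatoms≡2 n {x} {y} x≢0̂ x≼y ρy≡ =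
    count≡2 n _ (trans (sym (∑-const (level x y (ρ x + suc n)) coatom-chains))
                       (trans (sym (chains-via-coatoms (suc n) x y x≼y ρy≡)) (chains≡twoPowPred (suc (suc n)) x≢0̂ x≼y ρy≡)))
    where
      coatom-chains : ∀ {c} → c ∈ level x y (ρ x + suc n) → chainsFuel (suc n) x c ≡ 2 ^ n
      coatom-chains c∈ = let (x≼c , _ , ρc≡) = ∈-level⁻ c∈ in chains≡twoPowPred (suc n) x≢0̂ x≼c ρc≡

module ℤ-Sums = CommutativeMonoidSums ℤₚ.+-0-isCommutativeMonoid

sign-even : ∀ j → sign (j + j) ≡ + 1
sign-even zero    = refl
sign-even (suc j) rewrite +-suc j j = trans (ℤₚ.neg-involutive _) (sign-even j)

module EulerianProperties (P : GradedPoset) (eul : IsEulerian P) where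
  open GradedPosetProperties P

  private
    μFuel-unfold : ∀ k {x z} → ρ x < ρ z →
      μFuel (suc k) x z ≡ - sumℤ (map (μFuel k x) (filter (λ w → ρ w <? ρ z) (interval x z)))
    μFuel-unfold k {x} {z} ρx<ρz with ρ x <? ρ z
    ... | yes _     = refl
    ... | no ρx≮ρz = ⊥-elim (ρx≮ρz ρx<ρz)

    μFuel-stable : ∀ k k′ {x z} → ρ z < k → ρ z < k′ → μFuel k x z ≡ μFuel k′ x z
    μFuel-stable (suc k) (suc k′) {x} {z} ρz<k ρz<k′ with ρ x <? ρ z
    ... | no _  = refl
    ... | yes _ = cong -_ (ℤ-Sums.∑-map-cong (filter (λ w → ρ w <? ρ z) (interval x z)) λ w∈ →
        let ρw<ρz = proj₂ (∈-filter⁻ (λ w → ρ w <? ρ z) {xs = interval x z} w∈) in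
        μFuel-stable k k′ (<-≤-trans ρw<ρz (≤-pred ρz<k)) (<-≤-trans ρw<ρz (≤-pred ρz<k′)))

    μ0̂≡sign : ∀ z → μ 0̂ z ≡ sign (ρ z)
    μ0̂≡sign z = trans (eul 0̂ z (0̂-min z)) (cong (λ r → sign (ρ z ∸ r)) ρ-0̂)

    fuel-0̂ : ∀ z → ρ z < suc (ρ z ∸ ρ 0̂)
    fuel-0̂ z = subst (λ r → ρ z < suc (ρ z ∸ r)) (sym ρ-0̂) ≤-refl

  private
    strictlyBelow : Carrier → List Carrier
    strictlyBelow z = filter (λ w → ρ w <? ρ z) (interval 0̂ z)

    signs-strictlyBelow : ∀ z → ρ z ≢ 0 → - sumℤ (map (sign ∘ ρ) (strictlyBelow z)) ≡ sign (ρ z)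
    signs-strictlyBelow z ρz≢0 = begin
      - sumℤ (map (sign ∘ ρ) (strictlyBelow z))
        ≡⟨ cong -_ (ℤ-Sums.∑-map-cong (strictlyBelow z) λ {w} w∈ →
             let ρw<ρz = proj₂ (∈-filter⁻ (λ w → ρ w <? ρ z) {xs = interval 0̂ z} w∈) in
             trans (sym (μ0̂≡sign w)) (μFuel-stable _ (ρ z ∸ ρ 0̂) (fuel-0̂ w)
                                        (subst (λ r → ρ w < ρ z ∸ r) (sym ρ-0̂) ρw<ρz))) ⟩
      - sumℤ (map (μFuel (ρ z ∸ ρ 0̂) 0̂) (strictlyBelow z))
        ≡⟨ sym (μFuel-unfold (ρ z ∸ ρ 0̂) (subst (_< ρ z) (sym ρ-0̂) (n≢0⇒n>0 ρz≢0))) ⟩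
      μ 0̂ z
        ≡⟨ μ0̂≡sign z ⟩
      sign (ρ z) ∎
      where open ≡-Reasoning

  alternating-sum : ∀ z → ρ z ≢ 0 → sumℤ (map (sign ∘ ρ) (interval 0̂ z)) ≡ + 0
  alternating-sum z ρz≢0 = begin
    sumℤ (map s (interval 0̂ z))   ≡⟨ ℤ-Sums.∑-filter-split (λ w → ρ w <? ρ z) s (interval 0̂ z) ⟩
    below ℤ.+ sumℤ (map s notBelow) ≡⟨ cong (λ t → below ℤ.+ t) top-sum ⟩
    below ℤ.+ s z                   ≡⟨ cong (λ t → below ℤ.+ t) (sym (signs-strictlyBelow z ρz≢0)) ⟩
    below ℤ.+ - below               ≡⟨ ℤₚ.+-inverseʳ below ⟩
    + 0 ∎
    where
      open ≡-Reasoning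
      s = sign ∘ ρ
      below = sumℤ (map s (strictlyBelow z))
      notBelow = filter (λ w → ¬? (ρ w <? ρ z)) (interval 0̂ z)
      top-sum : sumℤ (map s notBelow) ≡ s z
      top-sum = trans
        (ℤ-Sums.∑-map-Unique s (Uniqueₚ.filter⁺ (λ w → ¬? (ρ w <? ρ z)) (interval-unique 0̂ z)) ([] ∷ [])
          (mk⇔ notBelow-only (λ { (here refl) → z∈notBelow ; (there ()) })))
        (ℤₚ.+-identityʳ (s z))
        where
          notBelow-only : ∀ {w} → w ∈ notBelow → w ∈ z ∷ []
          notBelow-only w∈ with ∈-filter⁻ (λ w → ¬? (ρ w <? ρ z)) {xs = interval 0̂ z} w∈
          ... | w∈I , ρw≮ρz = let w≼z = proj₂ (∈-interval⁻ w∈I) in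
                               here (≼∧ρ≡⇒≡ w≼z (≤-antisym (ρ-mono w≼z) (≮⇒≥ ρw≮ρz)))
          z∈notBelow : z ∈ notBelow
          z∈notBelow = ∈-filter⁺ (λ w → ¬? (ρ w <? ρ z)) (∈-interval⁺ (0̂-min z) ≼-refl) (<-irrefl refl)

indicator : ∀ {A : Set} → Dec A → ℤ → ℤ
indicator (yes _) v = v
indicator (no _)  v = + 0

∑ℤ-const : ∀ {A : Set} (xs : List A) {f : A → ℤ} {k} → (∀ {z} → z ∈ xs → f z ≡ k) → ℤ-Sums.∑ (map f xs) ≡ + length xs ℤ.* k
∑ℤ-const []       {k = k} _   = sym (ℤₚ.*-zeroˡ k)
∑ℤ-const (x ∷ xs) {k = k} f≡k =
  trans (cong₂ ℤ._+_ (f≡k (here refl)) (∑ℤ-const xs (f≡k ∘ there))) (sym (ℤₚ.suc-* (+ length xs) k))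

module EvenLength (P : GradedPoset) (S : IsSheffer P) (eul : IsEulerian P)
                  (B≡ : ∀ n → IsSheffer.B S n ≡ twoPowPred n) where
  open GradedPosetProperties P
  open EulerianProperties P eul
  open TwoPowBinomial P S B≡

  private
    ∑-indicator-rank : ∀ (xs : List Carrier) k v →
      sumℤ (map (λ z → indicator (ρ z ≟ k) v) xs) ≡ + length (filter (λ z → ρ z ≟ k) xs) ℤ.* v
    ∑-indicator-rank []       k v = sym (ℤₚ.*-zeroˡ v)
    ∑-indicator-rank (x ∷ xs) k v with ρ x ≟ k
    ... | yes ρx≡k = trans (cong (λ t → v ℤ.+ t) (∑-indicator-rank xs k v))
                       (trans (sym (ℤₚ.suc-* (+ length (filter (λ z → ρ z ≟ k) xs)) v))
                              (cong (λ t → + length t ℤ.* v) (sym (Listₚ.filter-accept (λ z → ρ z ≟ k) {x} {xs} ρx≡k))))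
    ... | no ρx≢k = trans (ℤₚ.+-identityˡ _)
                      (trans (∑-indicator-rank xs k v)
                             (cong (λ t → + length t ℤ.* v) (sym (Listₚ.filter-reject (λ z → ρ z ≟ k) {x} {xs} ρx≢k))))

    count-equation⇒c≡2 : ∀ c → (+ 1 ℤ.* (+ 2 ℤ.- + c) ℤ.+ + c ℤ.* -[1+ 0 ]) ℤ.+ + 1 ℤ.* + 2 ≡ + 0 → c ≡ 2
    count-equation⇒c≡2 c eq = *-cancelˡ-≡ c 2 2 (trans (cong (λ t → c + t) (+-identityʳ c))
      (sym (ℤₚ.+-injective (ℤₚ.i-j≡0⇒i≡j (+ 4) (+ (c + c)) (trans (sym (normalise (+ c))) eq)))))
      where
        normalise : ∀ x → (+ 1 ℤ.* (+ 2 ℤ.- x) ℤ.+ x ℤ.* -[1+ 0 ]) ℤ.+ + 1 ℤ.* + 2 ≡ + 4 ℤ.- (x ℤ.+ x)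
        normalise = solve-∀

    -- the four cases of pointwise below; the + 0 summands are the vanishing indicators of correction z
    at-bottom : ∀ sz N c → sz ≡ + 1 → N ≡ c → sz ℤ.+ sz ≡ + N ℤ.* sz ℤ.+ ((+ 2 ℤ.- + c ℤ.+ + 0) ℤ.+ + 0)
    at-bottom _ _ c refl refl = identity (+ c)
      where identity : ∀ x → + 1 ℤ.+ + 1 ≡ x ℤ.* + 1 ℤ.+ ((+ 2 ℤ.- x ℤ.+ + 0) ℤ.+ + 0)
            identity = solve-∀

    at-coatom : ∀ sz N → sz ≡ -[1+ 0 ] → N ≡ 1 → sz ℤ.+ sz ≡ + N ℤ.* sz ℤ.+ ((+ 0 ℤ.+ -[1+ 0 ]) ℤ.+ + 0)
    at-coatom _ _ refl refl = refl

    at-top : ∀ sz N → sz ≡ + 1 → N ≡ 0 → sz ℤ.+ sz ≡ + N ℤ.* sz ℤ.+ ((+ 0 ℤ.+ + 0) ℤ.+ + 2)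
    at-top _ _ refl refl = refl

    in-between : ∀ sz N → N ≡ 2 → sz ℤ.+ sz ≡ + N ℤ.* sz ℤ.+ ((+ 0 ℤ.+ + 0) ℤ.+ + 0)
    in-between sz _ refl = identity sz
      where identity : ∀ x → x ℤ.+ x ≡ + 2 ℤ.* x ℤ.+ ((+ 0 ℤ.+ + 0) ℤ.+ + 0)
            identity = solve-∀

    module EulerCount (j : ℕ) (Y : Carrier) (ρY≡ : ρ Y ≡ suc (suc (j + j))) where
      open ≡-Reasoning
      n′ = suc (j + j)
      IY = interval 0̂ Y
      coatoms = level 0̂ Y n′
      c = length coatoms
      s : Carrier → ℤ
      s = sign ∘ ρ
      N : Carrier → ℕ
      N z = length (level z Y n′)
      -- (2 - N z) · s z, which vanishes except at 0̂, the coatoms and Y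
      correction : Carrier → ℤ
      correction z = (indicator (ρ z ≟ 0) (+ 2 ℤ.- + c) ℤ.+ indicator (ρ z ≟ n′) -[1+ 0 ]) ℤ.+ indicator (ρ z ≟ suc n′) (+ 2)
      ρY≢0 : ρ Y ≢ 0
      ρY≢0 ρY≡0 = 1+n≢0 (trans (sym ρY≡) ρY≡0)

      ∑Ns≡0 : sumℤ (map (λ z → + N z ℤ.* s z) IY) ≡ + 0
      ∑Ns≡0 = begin
        sumℤ (map (λ z → + N z ℤ.* s z) IY)
          ≡⟨ sym (ℤ-Sums.∑-map-cong IY λ {z} _ → ∑ℤ-const (level z Y n′) (λ _ → refl)) ⟩
        sumℤ (map (λ z → sumℤ (map (λ _ → s z) (level z Y n′))) IY)
          ≡⟨ sym (ℤ-Sums.∑-swap coatoms (interval 0̂) IY (λ z → level z Y n′) (λ _ z → s z)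
                   (level-Unique _ _ _) (λ _ → interval-unique _ _) (interval-unique _ _) (λ _ → level-Unique _ _ _) below-coatom⇔) ⟩
        sumℤ (map (λ c → sumℤ (map s (interval 0̂ c))) coatoms)
          ≡⟨ ℤ-Sums.∑-map-cong coatoms (λ c∈ → alternating-sum _ (λ ρc≡0 → 1+n≢0 (trans (sym (proj₂ (proj₂ (∈-level⁻ c∈)))) ρc≡0))) ⟩
        sumℤ (map (λ _ → + 0) coatoms)
          ≡⟨ trans (∑ℤ-const coatoms (λ _ → refl)) (ℤₚ.*-zeroʳ (+ c)) ⟩
        + 0 ∎
        where
          below-coatom⇔ : ∀ c z → (c ∈ coatoms × z ∈ interval 0̂ c) ⇔ (z ∈ IY × c ∈ level z Y n′)
          below-coatom⇔ c z = mk⇔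
            (λ (c∈ , z∈) → let (_ , c≼Y , ρc≡) = ∈-level⁻ c∈ ; (_ , z≼c) = ∈-interval⁻ z∈ in
               ∈-interval⁺ (0̂-min z) (≼-trans z≼c c≼Y) , ∈-level⁺ z≼c c≼Y ρc≡)
            (λ (z∈ , c∈) → let (z≼c , c≼Y , ρc≡) = ∈-level⁻ c∈ in
               ∈-level⁺ (0̂-min c) c≼Y ρc≡ , ∈-interval⁺ (0̂-min z) z≼c)

      pointwise : ∀ {z} → z ∈ IY → s z ℤ.+ s z ≡ + N z ℤ.* s z ℤ.+ correction z
      pointwise {z} z∈ with ρ z ≟ 0 | ρ z ≟ n′ | ρ z ≟ suc n′
      ... | yes ρz≡0 | yes ρz≡n′ | _ = ⊥-elim (1+n≢0 (trans (sym ρz≡n′) ρz≡0))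
      ... | yes ρz≡0 | no _ | yes ρz≡Y = ⊥-elim (1+n≢0 (trans (sym ρz≡Y) ρz≡0))
      ... | yes ρz≡0 | no _ | no _ =
        at-bottom (s z) (N z) c (cong sign ρz≡0) (cong (λ t → length (level t Y n′)) (ρ≡0⇒≡0̂ ρz≡0))
      ... | no _ | yes ρz≡n′ | yes ρz≡Y = ⊥-elim (1+n≢n (trans (sym ρz≡Y) ρz≡n′))
      ... | no _ | yes ρz≡n′ | no _ =
        at-coatom (s z) (N z) (trans (cong sign ρz≡n′) (cong -_ (sign-even j)))
                  (length-level-bottom (proj₂ (∈-interval⁻ z∈)) ρz≡n′)
      ... | no _ | no _ | yes ρz≡Y =
        at-top (s z) (N z) (trans (cong sign ρz≡Y) (cong (-_ ∘ -_) (sign-even j))) (length-∉-all nothing-above)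
        where
          nothing-above : ∀ {w} → w ∉ level z Y n′
          nothing-above w∈ =
            let (z≼w , w≼Y , ρw≡) = ∈-level⁻ w∈
                z≡Y = ≼∧ρ≡⇒≡ (proj₂ (∈-interval⁻ z∈)) (trans ρz≡Y (sym ρY≡))
            in 1+n≢n (trans (sym ρY≡) (trans (cong ρ (antisym (subst (_≼ _) z≡Y z≼w) w≼Y)) ρw≡))
      ... | no ρz≢0 | no ρz≢n′ | no ρz≢Y = in-between (s z) (N z) N≡2
        where
          z≼Y = proj₂ (∈-interval⁻ z∈)
          ρz<n′ : ρ z < n′
          ρz<n′ = ≤∧≢⇒< (≤-pred (≤∧≢⇒< (subst (ρ z ≤_) ρY≡ (ρ-mono z≼Y)) ρz≢Y)) ρz≢n′
          gap = m≤n⇒∃[o]m+o≡n ρz<n′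
          ρz+gap : ρ z + suc (proj₁ gap) ≡ n′
          ρz+gap = trans (+-suc (ρ z) (proj₁ gap)) (proj₂ gap)
          N≡2 : N z ≡ 2
          N≡2 = trans (cong (λ k → length (level z Y k)) (sym ρz+gap))
                      (#coatoms≡2 (proj₁ gap) (ρ≢0⇒≢0̂ ρz≢0) z≼Y
                        (trans ρY≡ (sym (trans (+-suc (ρ z) (suc (proj₁ gap))) (cong suc ρz+gap)))))

      ∑correction≡0 : sumℤ (map correction IY) ≡ + 0
      ∑correction≡0 = begin
        sumℤ (map correction IY)                                        ≡⟨ sym (ℤₚ.+-identityˡ _) ⟩
        + 0 ℤ.+ sumℤ (map correction IY)                                ≡⟨ cong (λ t → t ℤ.+ sumℤ (map correction IY)) (sym ∑Ns≡0) ⟩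
        sumℤ (map (λ z → + N z ℤ.* s z) IY) ℤ.+ sumℤ (map correction IY) ≡⟨ sym (ℤ-Sums.∑-map-⊕ IY _ correction) ⟩
        sumℤ (map (λ z → + N z ℤ.* s z ℤ.+ correction z) IY)            ≡⟨ sym (ℤ-Sums.∑-map-cong IY pointwise) ⟩
        sumℤ (map (λ z → s z ℤ.+ s z) IY)                               ≡⟨ ℤ-Sums.∑-map-⊕ IY s s ⟩
        sumℤ (map s IY) ℤ.+ sumℤ (map s IY)                             ≡⟨ cong₂ ℤ._+_ (alternating-sum Y ρY≢0) (alternating-sum Y ρY≢0) ⟩
        + 0 ∎

      ∑correction≡count : (+ 1 ℤ.* (+ 2 ℤ.- + c) ℤ.+ + c ℤ.* -[1+ 0 ]) ℤ.+ + 1 ℤ.* + 2 ≡ + 0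
      ∑correction≡count = trans (sym (begin
        sumℤ (map correction IY)
          ≡⟨ ℤ-Sums.∑-map-⊕ IY _ (λ z → indicator (ρ z ≟ suc n′) (+ 2)) ⟩
        sumℤ (map (λ z → indicator (ρ z ≟ 0) (+ 2 ℤ.- + c) ℤ.+ indicator (ρ z ≟ n′) -[1+ 0 ]) IY)
          ℤ.+ sumℤ (map (λ z → indicator (ρ z ≟ suc n′) (+ 2)) IY)
          ≡⟨ cong (λ t → t ℤ.+ sumℤ (map (λ z → indicator (ρ z ≟ suc n′) (+ 2)) IY)) (ℤ-Sums.∑-map-⊕ IY _ _) ⟩
        (sumℤ (map (λ z → indicator (ρ z ≟ 0) (+ 2 ℤ.- + c)) IY) ℤ.+ sumℤ (map (λ z → indicator (ρ z ≟ n′) -[1+ 0 ]) IY))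
          ℤ.+ sumℤ (map (λ z → indicator (ρ z ≟ suc n′) (+ 2)) IY)
          ≡⟨ cong₂ ℤ._+_ (cong₂ ℤ._+_ (∑-indicator-rank IY 0 _) (∑-indicator-rank IY n′ _)) (∑-indicator-rank IY (suc n′) _) ⟩
        (+ length (level 0̂ Y 0) ℤ.* (+ 2 ℤ.- + c) ℤ.+ + c ℤ.* -[1+ 0 ]) ℤ.+ + length (level 0̂ Y (suc n′)) ℤ.* + 2
          ≡⟨ cong₂ (λ a b → (+ a ℤ.* (+ 2 ℤ.- + c) ℤ.+ + c ℤ.* -[1+ 0 ]) ℤ.+ + b ℤ.* + 2)
                   (length-level-bottom (0̂-min Y) ρ-0̂) (length-level-top (0̂-min Y) ρY≡) ⟩
        (+ 1 ℤ.* (+ 2 ℤ.- + c) ℤ.+ + c ℤ.* -[1+ 0 ]) ℤ.+ + 1 ℤ.* + 2 ∎)) ∑correction≡0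

  #coatoms-even≡2 : ∀ j Y → ρ Y ≡ suc (suc (j + j)) → length (level 0̂ Y (suc (j + j))) ≡ 2
  #coatoms-even≡2 j Y ρY≡ = count-equation⇒c≡2 _ (EulerCount.∑correction≡count j Y ρY≡)

  lower-cover-shared : ∀ i Y → ρ Y ≡ suc (suc (suc i + suc i)) → ∀ {c d z} →
                       c ⋖ Y → d ⋖ Y → ρ z ≡ suc i + suc i → z ⋖ c → z ⋖ d
  lower-cover-shared i Y ρY≡ {c} {d} {z} c⋖Y d⋖Y ρz≡ z⋖c = ≼∧ρ≡suc⇒⋖ z≼d (trans ρd≡ (cong suc (sym ρz≡)))
    where
      j = suc i
      coatoms = level 0̂ Y (suc (j + j))
      ρd≡ : ρ d ≡ suc (j + j)
      ρd≡ = suc-injective (trans (sym (⋖⇒ρ≡suc d⋖Y)) ρY≡)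
      z≼Y = ≼-trans (⋖⇒≼ z⋖c) (⋖⇒≼ c⋖Y)
      atoms = level z Y (suc (ρ z))
      #atoms : length atoms ≡ 2
      #atoms = #atoms≡2 0 (ρ≢0⇒≢0̂ (λ ρz≡0 → 1+n≢0 (trans (sym ρz≡) ρz≡0))) z≼Y
                 (trans ρY≡ (trans (cong (suc ∘ suc) (sym ρz≡)) (+-comm 2 (ρ z))))
      atoms⊆coatoms : ∀ {w} → w ∈ atoms → w ∈ coatoms
      atoms⊆coatoms w∈ = let (_ , w≼Y , ρw≡) = ∈-level⁻ w∈ in ∈-level⁺ (0̂-min _) w≼Y (trans ρw≡ (cong suc ρz≡))
      d∈atoms : d ∈ atoms
      d∈atoms = Unique-⊆-length≥⇒⊇ (level-Unique _ _ _) atoms⊆coatoms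
                  (≤-reflexive (trans (#coatoms-even≡2 j Y ρY≡) (sym #atoms)))
                  (λ u∈ v∈ → ≡-dec-below (proj₁ (proj₂ (∈-level⁻ u∈))) (proj₁ (proj₂ (∈-level⁻ v∈))))
                  (∈-level⁺ (0̂-min d) (⋖⇒≼ d⋖Y) ρd≡)
      z≼d = proj₁ (∈-level⁻ d∈atoms)

m+m≡n+n⇒m≡n : ∀ m n → m + m ≡ n + n → m ≡ n
m+m≡n+n⇒m≡n m n eq = trans (n≡⌊n+n/2⌋ m) (trans (cong ⌊_/2⌋ eq) (sym (n≡⌊n+n/2⌋ n)))

module OddLength (P : GradedPoset) (S : IsSheffer P) (eul : IsEulerian P)
                 (B≡ : ∀ n → IsSheffer.B S n ≡ twoPowPred n) where
  open GradedPosetProperties P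
  open TwoPowBinomial P S B≡
  open EvenLength P S eul B≡

  SameLowerCovers : Carrier → Carrier → Set
  SameLowerCovers e c = ∀ z → z ⋖ e ⇔ z ⋖ c

  SharedLowerCovers : ℕ → Carrier × Carrier → Set
  SharedLowerCovers r (c , d) = Σ Carrier λ a → Σ Carrier λ b →
    a ≢ b × ρ a ≡ r × ρ b ≡ r × (∀ z → (z ⋖ c ⇔ (z ≡ a ⊎ z ≡ b)) × (z ⋖ d ⇔ (z ≡ a ⊎ z ≡ b)))

  private
    same-sym : ∀ {x y} → SameLowerCovers x y → SameLowerCovers y x
    same-sym x~y z = mk⇔ (Equivalence.from (x~y z)) (Equivalence.to (x~y z))

    same-trans : ∀ {x y w} → SameLowerCovers x y → SameLowerCovers y w → SameLowerCovers x w
    same-trans x~y y~w z = mk⇔ (Equivalence.to (y~w z) ∘ Equivalence.to (x~y z))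
                               (Equivalence.from (x~y z) ∘ Equivalence.from (y~w z))

  module _ (i : ℕ) (Y : Carrier) (ρY≡ : ρ Y ≡ suc (suc (suc (suc i + suc i)))) where
    private
      j = suc i
      t = suc (j + j)

    coatoms : List Carrier
    coatoms = level 0̂ Y (suc t)

    ⋖⇒∈coatoms : ∀ {c} → c ⋖ Y → c ∈ coatoms
    ⋖⇒∈coatoms c⋖Y = ∈-level⁺ (0̂-min _) (⋖⇒≼ c⋖Y) (suc-injective (trans (sym (⋖⇒ρ≡suc c⋖Y)) ρY≡))

    ∈coatoms⇒⋖ : ∀ {c} → c ∈ coatoms → c ⋖ Y
    ∈coatoms⇒⋖ c∈ = let (_ , c≼Y , ρc≡) = ∈-level⁻ c∈ in ≼∧ρ≡suc⇒⋖ c≼Y (trans ρY≡ (cong suc (sym ρc≡)))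

    private
      ρ-coatom : ∀ {c} → c ∈ coatoms → ρ c ≡ suc t
      ρ-coatom = proj₂ ∘ proj₂ ∘ ∈-level⁻

      lowerCovers : Carrier → List Carrier
      lowerCovers c = level 0̂ c t

      lowerCover⇔ : ∀ {c} → c ∈ coatoms → ∀ z → z ⋖ c ⇔ z ∈ lowerCovers c
      lowerCover⇔ c∈ z = mk⇔
        (λ z⋖c → ∈-level⁺ (0̂-min z) (⋖⇒≼ z⋖c) (suc-injective (trans (sym (⋖⇒ρ≡suc z⋖c)) (ρ-coatom c∈))))
        (λ z∈ → let (_ , z≼c , ρz≡) = ∈-level⁻ z∈ in ≼∧ρ≡suc⇒⋖ z≼c (trans (ρ-coatom c∈) (cong suc (sym ρz≡))))

      #lowerCovers : ∀ {c} → c ∈ coatoms → length (lowerCovers c) ≡ 2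
      #lowerCovers c∈ = #coatoms-even≡2 j _ (ρ-coatom c∈)

      ρ≡t⇒≢0̂ : ∀ {a} → ρ a ≡ t → a ≢ 0̂
      ρ≡t⇒≢0̂ ρa≡ = ρ≢0⇒≢0̂ (λ ρa≡0 → 1+n≢0 (trans (sym ρa≡) ρa≡0))

    private
      module Mate {c} (c∈ : c ∈ coatoms) (a b : Carrier) (a≢b : a ≢ b) (a∈ : a ∈ lowerCovers c) (b∈ : b ∈ lowerCovers c)
                  (lower-c : ∀ {z} → z ∈ lowerCovers c → z ≡ a ⊎ z ≡ b) where
        a⋖c = Equivalence.from (lowerCover⇔ c∈ a) a∈
        b⋖c = Equivalence.from (lowerCover⇔ c∈ b) b∈
        c≼Y = ⋖⇒≼ (∈coatoms⇒⋖ c∈)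
        ρa≡ : ρ a ≡ t
        ρa≡ = proj₂ (proj₂ (∈-level⁻ a∈))
        a≼Y = ≼-trans (⋖⇒≼ a⋖c) c≼Y
        b≼Y = ≼-trans (⋖⇒≼ b⋖c) c≼Y
        atoms-a = level a Y (suc (ρ a))
        #atoms-a : length atoms-a ≡ 2
        #atoms-a = #atoms≡2 0 (ρ≡t⇒≢0̂ ρa≡) a≼Y (trans ρY≡ (trans (cong (suc ∘ suc) (sym ρa≡)) (+-comm 2 (ρ a))))
        c∈atoms-a : c ∈ atoms-a
        c∈atoms-a = ∈-level⁺ (⋖⇒≼ a⋖c) c≼Y (⋖⇒ρ≡suc a⋖c)

        mate′ : (Σ Carrier λ d → d ∈ atoms-a × d ≢ c × (∀ {e} → e ∈ atoms-a → e ≡ c ⊎ e ≡ d)) →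
                (Σ Carrier λ w → 0̂ ≼ w × w ⋖ a) → HasUniqueMate SameLowerCovers coatoms c
        mate′ (d , d∈atoms-a , d≢c , only-atoms-a) (w , _ , w⋖a) = d , d∈ , d≢c , same-sym d~c , only-mates
          where
            a⋖d : a ⋖ d
            a⋖d = ≼∧ρ≡suc⇒⋖ (proj₁ (∈-level⁻ d∈atoms-a)) (proj₂ (proj₂ (∈-level⁻ d∈atoms-a)))
            d≼Y = proj₁ (proj₂ (∈-level⁻ d∈atoms-a))
            ρd≡ : ρ d ≡ suc t
            ρd≡ = trans (⋖⇒ρ≡suc a⋖d) (cong suc ρa≡)
            d∈ : d ∈ coatoms
            d∈ = ∈-level⁺ (0̂-min d) d≼Y ρd≡
            ρw≡ : ρ w ≡ j + j
            ρw≡ = suc-injective (trans (sym (⋖⇒ρ≡suc w⋖a)) ρa≡)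
            w≼Y = ≼-trans (⋖⇒≼ w⋖a) a≼Y
            #atoms-w : length (level w Y (suc (ρ w))) ≡ 2
            #atoms-w = #atoms≡2 1 (ρ≢0⇒≢0̂ (λ ρw≡0 → 1+n≢0 (trans (sym ρw≡) ρw≡0))) w≼Y
                         (trans ρY≡ (trans (cong (suc ∘ suc ∘ suc) (sym ρw≡)) (+-comm 3 (ρ w))))
            atom-w : ∀ {z} → w ⋖ z → z ≼ Y → z ∈ level w Y (suc (ρ w))
            atom-w w⋖z z≼Y = ∈-level⁺ (⋖⇒≼ w⋖z) z≼Y (⋖⇒ρ≡suc w⋖z)
            w⋖b : w ⋖ b
            w⋖b = lower-cover-shared i _ (ρ-coatom c∈) a⋖c b⋖c ρw≡ w⋖a
            lower-d⊆ab : ∀ {z} → z ⋖ d → z ≡ a ⊎ z ≡ b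
            lower-d⊆ab z⋖d = ∈-length≡2 #atoms-w (atom-w w⋖a a≼Y) (atom-w w⋖b b≼Y) a≢b
                               (atom-w (lower-cover-shared i _ ρd≡ a⋖d z⋖d ρw≡ w⋖a) (≼-trans (⋖⇒≼ z⋖d) d≼Y))
            b⋖d : b ⋖ d
            b⋖d with other (#lowerCovers d∈) (level-Unique _ _ _) (Equivalence.to (lowerCover⇔ d∈ a) a⋖d)
            ... | z , z∈ , z≢a , _ with Equivalence.from (lowerCover⇔ d∈ z) z∈
            ...   | z⋖d with lower-d⊆ab z⋖d
            ...     | inj₁ z≡a  = ⊥-elim (z≢a z≡a)
            ...     | inj₂ refl = z⋖d
            covers-d : ∀ {z} → z ≡ a ⊎ z ≡ b → z ⋖ d
            covers-d (inj₁ refl) = a⋖d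
            covers-d (inj₂ refl) = b⋖d
            covers-c : ∀ {z} → z ≡ a ⊎ z ≡ b → z ⋖ c
            covers-c (inj₁ refl) = a⋖c
            covers-c (inj₂ refl) = b⋖c
            d~c : SameLowerCovers d c
            d~c z = mk⇔ (covers-c ∘ lower-d⊆ab) (covers-d ∘ lower-c ∘ Equivalence.to (lowerCover⇔ c∈ z))
            only-mates : ∀ {e} → e ∈ coatoms → SameLowerCovers c e → e ≡ c ⊎ e ≡ d
            only-mates e∈ c~e = let a⋖e = Equivalence.to (c~e a) a⋖c in
              only-atoms-a (∈-level⁺ (⋖⇒≼ a⋖e) (proj₁ (proj₂ (∈-level⁻ e∈))) (⋖⇒ρ≡suc a⋖e))

        mate : HasUniqueMate SameLowerCovers coatoms c
        mate = mate′ (other #atoms-a (level-Unique _ _ _) c∈atoms-a) (cover-below (0̂-min a) (ρ≡t⇒≢0̂ ρa≡ ∘ sym))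

    -- If a, b are the lower covers of c, the mate of c is the other atom d of [a,Y]: every lower cover
    -- of d covers a fixed lower cover w of a, hence is one of the two atoms a, b of [w,Y].
    coatom-mate : ∀ {c} → c ∈ coatoms → HasUniqueMate SameLowerCovers coatoms c
    coatom-mate c∈ with length≡2⇒pair (#lowerCovers c∈) (level-Unique _ _ _)
    ... | a , b , a≢b , a∈ , b∈ , lower-c = Mate.mate c∈ a b a≢b a∈ b∈ lower-c

    abstract
      coatom-pairing : PerfectMatching SameLowerCovers coatoms
      coatom-pairing = perfectMatching same-sym same-trans coatoms (level-Unique _ _ _)
        (λ u∈ v∈ → ≡-dec-below (proj₁ (proj₂ (∈-level⁻ u∈))) (proj₁ (proj₂ (∈-level⁻ v∈)))) coatom-mate

    shared-lower-covers : ∀ {c d} → c ∈ coatoms → SameLowerCovers c d → SharedLowerCovers t (c , d)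
    shared-lower-covers {c} {d} c∈ c~d with length≡2⇒pair (#lowerCovers c∈) (level-Unique _ _ _)
    ... | a , b , a≢b , a∈ , b∈ , lower-c =
      a , b , a≢b , proj₂ (proj₂ (∈-level⁻ a∈)) , proj₂ (proj₂ (∈-level⁻ b∈)) ,
      λ z → lower-c⇔ z , mk⇔ (Equivalence.to (lower-c⇔ z) ∘ Equivalence.from (c~d z))
                             (Equivalence.to (c~d z) ∘ Equivalence.from (lower-c⇔ z))
      where
        lower-c⇔ : ∀ z → z ⋖ c ⇔ (z ≡ a ⊎ z ≡ b)
        lower-c⇔ z = mk⇔ (lower-c ∘ Equivalence.to (lowerCover⇔ c∈ z))
                         (λ { (inj₁ refl) → Equivalence.from (lowerCover⇔ c∈ a) a∈
                            ; (inj₂ refl) → Equivalence.from (lowerCover⇔ c∈ b) b∈ })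

module RankThree (P : GradedPoset) (S : IsSheffer P) (eul : IsEulerian P)
                 (B≡ : ∀ n → IsSheffer.B S n ≡ twoPowPred n)
                 (Y : GradedPoset.Carrier P) (ρY≡3 : GradedPoset.ρ P Y ≡ 3) where
  open GradedPosetProperties P
  open TwoPowBinomial P S B≡
  open EvenLength P S eul B≡

  atoms edges : List Carrier
  atoms = level 0̂ Y 1
  edges = level 0̂ Y 2

  atomsBelow : Carrier → List Carrier
  atomsBelow e = level 0̂ e 1

  edgesAbove : Carrier → List Carrier
  edgesAbove a = level a Y 2

  #atomsBelow : ∀ {e} → ρ e ≡ 2 → length (atomsBelow e) ≡ 2
  #atomsBelow ρe≡2 = #coatoms-even≡2 0 _ ρe≡2

  #edgesAbove : ∀ {a} → a ≼ Y → ρ a ≡ 1 → length (edgesAbove a) ≡ 2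
  #edgesAbove {a} a≼Y ρa≡1 = trans (cong (length ∘ level a Y) (cong suc (sym ρa≡1)))
    (#atoms≡2 0 (ρ≢0⇒≢0̂ (λ ρa≡0 → 1+n≢0 (trans (sym ρa≡1) ρa≡0))) a≼Y
      (trans ρY≡3 (trans (cong (suc ∘ suc) (sym ρa≡1)) (+-comm 2 (ρ a)))))

  record Flag : Set where
    field
      point line : Carrier
      point≼line : point ≼ line
      line≼Y : line ≼ Y
      ρ-point : ρ point ≡ 1
      ρ-line : ρ line ≡ 2

    point∈atoms : point ∈ atoms
    point∈atoms = ∈-level⁺ (0̂-min point) (≼-trans point≼line line≼Y) ρ-point

    line∈edges : line ∈ edges
    line∈edges = ∈-level⁺ (0̂-min line) line≼Y ρ-line

  open Flag

  corner : Flag → Carrier × Carrier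
  corner f = point f , line f

  record Follows (f g : Flag) : Set where
    field
      point≢ : point g ≢ point f
      atomsBelow-line : ∀ {x} → x ∈ atomsBelow (line f) → x ≡ point f ⊎ x ≡ point g
      point∈atomsBelow : point g ∈ atomsBelow (line f)
      line≢ : line g ≢ line f
      edgesAbove-point : ∀ {x} → x ∈ edgesAbove (point g) → x ≡ line f ⊎ x ≡ line g

  private
    next′ : (f : Flag) → Σ Flag (Follows f)
    next′ f with other (#atomsBelow (ρ-line f)) (level-Unique _ _ _) (∈-level⁺ (0̂-min _) (point≼line f) (ρ-point f))
    ... | a′ , a′∈ , a′≢a , atoms-e with ∈-level⁻ a′∈
    ...   | _ , a′≼e , ρa′≡1
      with other (#edgesAbove (≼-trans a′≼e (line≼Y f)) ρa′≡1) (level-Unique _ _ _) (∈-level⁺ a′≼e (line≼Y f) (ρ-line f))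
    ...     | e′ , e′∈ , e′≢e , edges-a′ with ∈-level⁻ e′∈
    ...       | a′≼e′ , e′≼Y , ρe′≡2 =
      record { point = a′ ; line = e′ ; point≼line = a′≼e′ ; line≼Y = e′≼Y ; ρ-point = ρa′≡1 ; ρ-line = ρe′≡2 } ,
      record { point≢ = a′≢a ; atomsBelow-line = atoms-e ; point∈atomsBelow = a′∈
             ; line≢ = e′≢e ; edgesAbove-point = edges-a′ }

  abstract
    next : Flag → Flag
    next f = proj₁ (next′ f)

    next-follows : ∀ f → Follows f (next f)
    next-follows f = proj₂ (next′ f)

  follows-injective : ∀ {f₁ f₂ g₁ g₂} → Follows f₁ g₁ → Follows f₂ g₂ → corner g₁ ≡ corner g₂ → corner f₁ ≡ corner f₂
  follows-injective {f₁} {f₂} {g₁} {g₂} f₁→g₁ f₂→g₂ g₁≡g₂ = cong₂ _,_ point≡ line≡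
    where
      open Follows
      point-g≡ = cong proj₁ g₁≡g₂
      line-g≡ = cong proj₂ g₁≡g₂
      line≡ : line f₁ ≡ line f₂
      line≡ with edgesAbove-point f₂→g₂ (∈-level⁺ (subst (_≼ line f₁) point-g≡ (proj₁ (proj₂ (∈-level⁻ (point∈atomsBelow f₁→g₁)))))
                                                (line≼Y f₁) (ρ-line f₁))
      ... | inj₁ e₁≡e₂ = e₁≡e₂
      ... | inj₂ e₁≡e′ = ⊥-elim (line≢ f₁→g₁ (trans line-g≡ (sym e₁≡e′)))
      point≡ : point f₁ ≡ point f₂
      point≡ with atomsBelow-line f₂→g₂ (subst (λ e → point f₁ ∈ atomsBelow e) line≡ (∈-level⁺ (0̂-min _) (point≼line f₁) (ρ-point f₁)))
      ... | inj₁ a₁≡a₂ = a₁≡a₂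
      ... | inj₂ a₁≡a′ = ⊥-elim (point≢ f₁→g₁ (trans point-g≡ (sym a₁≡a′)))

  record Polygon : Set where
    field
      size : ℕ
      2≤size : 2 ≤ size
      vertex side : ℕ → Carrier
      vertex∈atoms : ∀ k → vertex k ∈ atoms
      side∈edges : ∀ k → side k ∈ edges
      ends-of-side : ∀ k → vertex k ≼ side k × vertex (suc k) ≼ side k
      incidence : ∀ j k → j < size → k < size →
                  vertex j ≼ side k ⇔ (j ≡ k ⊎ j ≡ suc k ⊎ (j ≡ 0 × suc k ≡ size))
      vertex-injective : ∀ j j′ → j < size → j′ < size → vertex j ≡ vertex j′ → j ≡ j′
      side-injective : ∀ k k′ → k < size → k′ < size → side k ≡ side k′ → k ≡ k′
      sides-closed : ∀ j → j < size → ∀ e → e ∈ edges → vertex j ≼ e → Σ ℕ λ k → k < size × e ≡ side k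
      vertices-closed : ∀ k → k < size → ∀ a → a ∈ atoms → a ≼ side k → Σ ℕ λ j → j < size × a ≡ vertex j

  module Orbit (f₀ : Flag) where
    flags : ℕ → Flag
    flags zero    = f₀
    flags (suc k) = next (flags k)

    vertex side : ℕ → Carrier
    vertex = point ∘ flags
    side = line ∘ flags

    follows : ∀ k → Follows (flags k) (flags (suc k))
    follows k = next-follows (flags k)

    shift-cancel : ∀ i d → corner (flags (i + d)) ≡ corner (flags i) → corner (flags d) ≡ corner f₀
    shift-cancel zero    d eq = eq
    shift-cancel (suc i) d eq = shift-cancel i d (follows-injective (follows (i + d)) (follows i) eq)

    corner≟ : ∀ i j → Dec (corner (flags i) ≡ corner (flags j))
    corner≟ i j with ≡-dec-below (≼-trans (point≼line (flags i)) (line≼Y (flags i)))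
                                 (≼-trans (point≼line (flags j)) (line≼Y (flags j)))
                   | ≡-dec-below (line≼Y (flags i)) (line≼Y (flags j))
    ... | yes a≡ | yes e≡ = yes (cong₂ _,_ a≡ e≡)
    ... | no a≢  | _      = no (a≢ ∘ cong proj₁)
    ... | yes _  | no e≢  = no (e≢ ∘ cong proj₂)

    private
      corners = cartesianProduct atoms edges

      corner∈ : ∀ k → corner (flags k) ∈ corners
      corner∈ k = ∈-cartesianProduct⁺ (point∈atoms (flags k)) (line∈edges (flags k))

      returns′ : (Σ (Fin (suc (length corners))) λ i → Σ (Fin (suc (length corners))) λ j →
                  i Fin.< j × index (corner∈ (toℕ i)) ≡ index (corner∈ (toℕ j))) →
                 Σ ℕ λ d → 1 ≤ d × corner (flags d) ≡ corner f₀
      returns′ (i , j , i<j , same-index) =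
        toℕ j ∸ toℕ i , m<n⇒0<n∸m i<j ,
        shift-cancel (toℕ i) (toℕ j ∸ toℕ i) (trans (cong (corner ∘ flags) (m+[n∸m]≡n (<⇒≤ i<j))) (sym same))
        where
          same : corner (flags (toℕ i)) ≡ corner (flags (toℕ j))
          same = trans (lookup-index (corner∈ (toℕ i)))
                       (trans (cong (lookup corners) same-index) (sym (lookup-index (corner∈ (toℕ j)))))

    returns : Σ ℕ λ d → 1 ≤ d × corner (flags d) ≡ corner f₀
    returns = returns′ (Finₚ.pigeonhole (n<1+n (length corners)) (λ i → index (corner∈ (toℕ i))))

    private
      vertex-moves : ∀ k → vertex (suc k) ≢ vertex k
      vertex-moves k = Follows.point≢ (follows k)

      side-moves : ∀ k → side (suc k) ≢ side k
      side-moves k = Follows.line≢ (follows k)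

      atomsBelow-side : ∀ k {x} → x ∈ atomsBelow (side k) → x ≡ vertex k ⊎ x ≡ vertex (suc k)
      atomsBelow-side k = Follows.atomsBelow-line (follows k)

      edgesAbove-vertex : ∀ k {x} → x ∈ edgesAbove (vertex (suc k)) → x ≡ side k ⊎ x ≡ side (suc k)
      edgesAbove-vertex k = Follows.edgesAbove-point (follows k)

      vertex≼side : ∀ k → vertex k ≼ side k
      vertex≼side k = point≼line (flags k)

      vertex-suc≼side : ∀ k → vertex (suc k) ≼ side k
      vertex-suc≼side k = proj₁ (proj₂ (∈-level⁻ (Follows.point∈atomsBelow (follows k))))

      ∈atomsBelow-side : ∀ {x} k → x ≼ side k → ρ x ≡ 1 → x ∈ atomsBelow (side k)
      ∈atomsBelow-side k x≼ ρx≡ = ∈-level⁺ (0̂-min _) x≼ ρx≡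

      ∈edgesAbove-vertex : ∀ {x} k → vertex k ≼ x → x ≼ Y → ρ x ≡ 2 → x ∈ edgesAbove (vertex k)
      ∈edgesAbove-vertex k = ∈-level⁺

    module Closing (q : ℕ) (least : IsLeastPositive (λ k → corner (flags k) ≡ corner f₀) q) where
      private
        q≥1 : 1 ≤ q
        q≥1 = proj₁ least
        closes : corner (flags q) ≡ corner f₀
        closes = proj₁ (proj₂ least)
        minimal : ∀ k → 1 ≤ k → k < q → corner (flags k) ≢ corner f₀
        minimal = proj₂ (proj₂ least)

        vertex-q : vertex q ≡ vertex 0
        vertex-q = cong proj₁ closes

        side-q : side q ≡ side 0
        side-q = cong proj₂ closes

        2≤q : 2 ≤ q
        2≤q = ≤∧≢⇒< q≥1 λ { refl → vertex-moves 0 vertex-q }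

        flags-distinct : ∀ i j → i < j → j < q → corner (flags i) ≢ corner (flags j)
        flags-distinct i j i<j j<q eq = minimal (j ∸ i) (m<n⇒0<n∸m i<j) (≤-trans (s≤s (m∸n≤m j i)) j<q)
          (shift-cancel i (j ∸ i) (trans (cong (corner ∘ flags) (m+[n∸m]≡n (<⇒≤ i<j))) (sym eq)))

        revisit-side : ∀ g i j → j ≡ suc (i + g) → j < q → vertex i ≡ vertex j → side i ≡ side (i + g)
        revisit-side g i j refl j<q vi≡vj
          with edgesAbove-vertex (i + g) (subst (λ a → side i ∈ edgesAbove a) vi≡vj
                                           (∈edgesAbove-vertex i (vertex≼side i) (line≼Y (flags i)) (ρ-line (flags i))))
        ... | inj₁ si≡ = si≡
        ... | inj₂ si≡ = ⊥-elim (flags-distinct i j (s≤s (m≤m+n i g)) j<q (cong₂ _,_ vi≡vj si≡))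

        vertices-distinct′ : ∀ g i j → j ≡ i + suc g → j < q → vertex i ≢ vertex j
        vertices-distinct′ zero i j refl j<q vi≡vj =
          vertex-moves i (sym (trans vi≡vj (cong vertex (+-comm i 1))))
        vertices-distinct′ (suc zero) i j refl j<q vi≡vj =
          side-moves i (sym (trans (revisit-side 1 i j (+-suc i 1) j<q vi≡vj) (cong side (+-comm i 1))))
        vertices-distinct′ (suc (suc g)) i j refl j<q vi≡vj
          with atomsBelow-side (i + suc (suc g))
                 (subst (λ e → vertex (suc i) ∈ atomsBelow e) (revisit-side (suc (suc g)) i j (+-suc i (suc (suc g))) j<q vi≡vj)
                        (∈atomsBelow-side i (vertex-suc≼side i) (ρ-point (flags (suc i)))))
        ... | inj₁ v≡ = vertices-distinct′ g (suc i) (i + suc (suc g)) (+-suc i (suc g))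
                          (<-trans (+-monoʳ-< i (n<1+n (suc (suc g)))) j<q) v≡
        ... | inj₂ v≡ = vertex-moves i (trans v≡ (trans (cong vertex (sym (+-suc i (suc (suc g))))) (sym vi≡vj)))

        vertices-distinct : ∀ j j′ → j < j′ → j′ < q → vertex j ≢ vertex j′
        vertices-distinct j j′ j<j′ j′<q = let (o , eo) = m≤n⇒∃[o]m+o≡n j<j′ in
          vertices-distinct′ o j j′ (trans (sym eo) (sym (+-suc j o))) j′<q

        vertex-injective : ∀ j j′ → j < q → j′ < q → vertex j ≡ vertex j′ → j ≡ j′
        vertex-injective j j′ j<q j′<q eq with <-cmp j j′
        ... | tri< j<j′ _ _ = ⊥-elim (vertices-distinct j j′ j<j′ j′<q eq)
        ... | tri≈ _ j≡j′ _ = j≡j′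
        ... | tri> _ _ j′<j = ⊥-elim (vertices-distinct j′ j j′<j j<q (sym eq))

        next-index : ∀ {k} → k < q → suc k < q ⊎ suc k ≡ q
        next-index = m≤n⇒m<n∨m≡n

        sides-distinct : ∀ k k′ → k < k′ → k′ < q → side k ≢ side k′
        sides-distinct k k′ k<k′ k′<q sk≡sk′ =
          cases (atomsBelow-side k (subst (λ e → vertex (suc k′) ∈ atomsBelow e) (sym sk≡sk′)
                                     (∈atomsBelow-side k′ (vertex-suc≼side k′) (ρ-point (flags (suc k′))))))
                (next-index k′<q)
          where
            cases : vertex (suc k′) ≡ vertex k ⊎ vertex (suc k′) ≡ vertex (suc k) → suc k′ < q ⊎ suc k′ ≡ q → ⊥
            cases (inj₁ v≡) (inj₁ sk′<q) = vertices-distinct k (suc k′) (<-trans k<k′ (n<1+n k′)) sk′<q (sym v≡)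
            cases (inj₂ v≡) (inj₁ sk′<q) = vertices-distinct (suc k) (suc k′) (s≤s k<k′) sk′<q (sym v≡)
            cases (inj₁ v≡) (inj₂ refl)
              with vertex-injective k 0 (<-trans k<k′ k′<q) (≤-trans (s≤s z≤n) k′<q) (trans (sym v≡) vertex-q)
            ... | refl = side-moves k′ (trans side-q sk≡sk′)
            cases (inj₂ v≡) (inj₂ refl) =
              1+n≢0 (vertex-injective (suc k) 0 (≤-trans (s≤s k<k′) k′<q) (≤-trans (s≤s z≤n) k′<q) (trans (sym v≡) vertex-q))

        side-injective : ∀ k k′ → k < q → k′ < q → side k ≡ side k′ → k ≡ k′
        side-injective k k′ k<q k′<q eq with <-cmp k k′
        ... | tri< k<k′ _ _ = ⊥-elim (sides-distinct k k′ k<k′ k′<q eq)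
        ... | tri≈ _ k≡k′ _ = k≡k′
        ... | tri> _ _ k′<k = ⊥-elim (sides-distinct k′ k k′<k k<q (sym eq))

        incidence : ∀ j k → j < q → k < q → vertex j ≼ side k ⇔ (j ≡ k ⊎ j ≡ suc k ⊎ (j ≡ 0 × suc k ≡ q))
        incidence j k j<q k<q = mk⇔ to from
          where
            to′ : vertex j ≡ vertex k ⊎ vertex j ≡ vertex (suc k) → suc k < q ⊎ suc k ≡ q →
                  j ≡ k ⊎ j ≡ suc k ⊎ (j ≡ 0 × suc k ≡ q)
            to′ (inj₁ v≡) _            = inj₁ (vertex-injective j k j<q k<q v≡)
            to′ (inj₂ v≡) (inj₁ sk<q)  = inj₂ (inj₁ (vertex-injective j (suc k) j<q sk<q v≡))
            to′ (inj₂ v≡) (inj₂ refl) =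
              inj₂ (inj₂ (vertex-injective j 0 j<q (≤-trans (s≤s z≤n) k<q) (trans v≡ vertex-q) , refl))
            to : vertex j ≼ side k → j ≡ k ⊎ j ≡ suc k ⊎ (j ≡ 0 × suc k ≡ q)
            to vj≼sk = to′ (atomsBelow-side k (∈atomsBelow-side k vj≼sk (ρ-point (flags j)))) (next-index k<q)
            from : j ≡ k ⊎ j ≡ suc k ⊎ (j ≡ 0 × suc k ≡ q) → vertex j ≼ side k
            from (inj₁ refl)                = vertex≼side k
            from (inj₂ (inj₁ refl))         = vertex-suc≼side k
            from (inj₂ (inj₂ (refl , sk≡q))) = subst (_≼ side k) (trans (cong vertex sk≡q) vertex-q) (vertex-suc≼side k)

        sides-closed : ∀ j → j < q → ∀ e → e ∈ edges → vertex j ≼ e → Σ ℕ λ k → k < q × e ≡ side k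
        sides-closed (suc j) sj<q e e∈ vj≼e
          with edgesAbove-vertex j (∈edgesAbove-vertex (suc j) vj≼e (proj₁ (proj₂ (∈-level⁻ e∈))) (proj₂ (proj₂ (∈-level⁻ e∈))))
        ... | inj₁ e≡ = j , <-trans (n<1+n j) sj<q , e≡
        ... | inj₂ e≡ = suc j , sj<q , e≡
        sides-closed zero _ e e∈ v0≼e = around q refl q≥1
          where
            around : ∀ q′ → q′ ≡ q → 1 ≤ q′ → Σ ℕ λ k → k < q × e ≡ side k
            around (suc q″) refl _
              with edgesAbove-vertex q″ (subst (λ a → e ∈ edgesAbove a) (sym vertex-q)
                     (∈edgesAbove-vertex 0 v0≼e (proj₁ (proj₂ (∈-level⁻ e∈))) (proj₂ (proj₂ (∈-level⁻ e∈)))))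
            ... | inj₁ e≡ = q″ , ≤-refl , e≡
            ... | inj₂ e≡ = 0 , q≥1 , trans e≡ side-q

        vertices-closed : ∀ k → k < q → ∀ a → a ∈ atoms → a ≼ side k → Σ ℕ λ j → j < q × a ≡ vertex j
        vertices-closed k k<q a a∈ a≼sk with atomsBelow-side k (∈atomsBelow-side k a≼sk (proj₂ (proj₂ (∈-level⁻ a∈))))
        ... | inj₁ a≡ = k , k<q , a≡
        ... | inj₂ a≡ with next-index k<q
        ...   | inj₁ sk<q = suc k , sk<q , a≡
        ...   | inj₂ refl = 0 , q≥1 , trans a≡ vertex-q

      polygon : Polygon
      polygon = record
        { size = q ; 2≤size = 2≤q ; vertex = vertex ; side = side
        ; vertex∈atoms = point∈atoms ∘ flags ; side∈edges = line∈edges ∘ flags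
        ; ends-of-side = λ k → vertex≼side k , vertex-suc≼side k
        ; incidence = incidence ; vertex-injective = vertex-injective ; side-injective = side-injective
        ; sides-closed = sides-closed ; vertices-closed = vertices-closed }

  abstract
    polygonThrough : Flag → Polygon
    polygonThrough f₀ = Closing.polygon (proj₁ least) (proj₂ least)
      where
        open Orbit f₀
        least : Σ ℕ (IsLeastPositive (λ k → corner (flags k) ≡ corner f₀))
        least = leastPositive (λ k → corner≟ k 0) (proj₁ returns) (proj₁ (proj₂ returns)) (proj₂ (proj₂ returns))

    polygonThrough-vertex₀ : ∀ f₀ → Polygon.vertex (polygonThrough f₀) 0 ≡ point f₀
    polygonThrough-vertex₀ f₀ = refl

  open Polygon

  OnPolygon : Polygon → Carrier → Set
  OnPolygon p a = Σ ℕ λ j → j < size p × vertex p j ≡ a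

  ClosedUnderEdges : List Carrier → Set
  ClosedUnderEdges R = ∀ {a a′ e} → a ∈ R → a′ ∈ atoms → e ∈ edges → a ≼ e → a′ ≼ e → a′ ∈ R

  record Decomposition (R : List Carrier) : Set where
    field
      r : ℕ
      polygons : Vec Polygon r
      covers : ∀ {a} → a ∈ R → Σ (Fin r) λ i → OnPolygon (Vec.lookup polygons i) a
      disjoint : ∀ i i′ j j′ → j < size (Vec.lookup polygons i) → j′ < size (Vec.lookup polygons i′) →
                 vertex (Vec.lookup polygons i) j ≡ vertex (Vec.lookup polygons i′) j′ → i ≡ i′
      inside : ∀ i j → j < size (Vec.lookup polygons i) → vertex (Vec.lookup polygons i) j ∈ R

  private
    ∈atoms⇒≼Y : ∀ {a} → a ∈ atoms → a ≼ Y
    ∈atoms⇒≼Y = proj₁ ∘ proj₂ ∘ ∈-level⁻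

    module PeelPolygon (a₀ : Carrier) (R′ : List Carrier) (u : Unique (a₀ ∷ R′))
                       (R⊆ : ∀ {a} → a ∈ a₀ ∷ R′ → a ∈ atoms) (closed : ClosedUnderEdges (a₀ ∷ R′)) where
      R = a₀ ∷ R′
      a₀∈atoms = R⊆ (here refl)

      flag₀ : Flag
      flag₀ with length≡2⇒pair (#edgesAbove (∈atoms⇒≼Y a₀∈atoms) (proj₂ (proj₂ (∈-level⁻ a₀∈atoms)))) (level-Unique _ _ _)
      ... | e₀ , _ , _ , e₀∈ , _ = record
        { point = a₀ ; line = e₀ ; point≼line = proj₁ (∈-level⁻ e₀∈) ; line≼Y = proj₁ (proj₂ (∈-level⁻ e₀∈))
        ; ρ-point = proj₂ (proj₂ (∈-level⁻ a₀∈atoms)) ; ρ-line = proj₂ (proj₂ (∈-level⁻ e₀∈)) }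

      p = polygonThrough flag₀

      vertex∈R : ∀ j → vertex p j ∈ R
      vertex∈R zero    = subst (_∈ R) (sym (polygonThrough-vertex₀ flag₀)) (here refl)
      vertex∈R (suc j) = closed (vertex∈R j) (vertex∈atoms p (suc j)) (side∈edges p j)
                                (proj₁ (ends-of-side p j)) (proj₂ (ends-of-side p j))

      onPolygon? : ∀ {a} → a ∈ R → Dec (OnPolygon p a)
      onPolygon? a∈ = anyUpTo? (λ j → ≡-dec-below (∈atoms⇒≼Y (vertex∈atoms p j)) (∈atoms⇒≼Y (R⊆ a∈))) (size p)

      rest = reject R onPolygon?
      rest⊆R : ∀ {a} → a ∈ rest → a ∈ R
      rest⊆R = proj₁ ∘ ∈-reject⁻ R onPolygon?
      off-polygon : ∀ {a} → a ∈ rest → ¬ OnPolygon p a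
      off-polygon = proj₂ ∘ ∈-reject⁻ R onPolygon?

      rest-shorter : length rest < length R
      rest-shorter = reject-shorter R onPolygon? u (here refl)
                       (0 , ≤-trans (s≤s z≤n) (2≤size p) , polygonThrough-vertex₀ flag₀)

      rest-closed : ClosedUnderEdges rest
      rest-closed {a} {a′} {e} a∈ a′∈ e∈ a≼e a′≼e with onPolygon? (closed (rest⊆R a∈) a′∈ e∈ a≼e a′≼e)
      ... | no off = ∈-reject⁺ R onPolygon? (closed (rest⊆R a∈) a′∈ e∈ a≼e a′≼e) off
      ... | yes (j , j<q , vj≡a′) =
        let (k , k<q , e≡) = sides-closed p j j<q e e∈ (subst (_≼ e) (sym vj≡a′) a′≼e)
            (j′ , j′<q , a≡) = vertices-closed p k k<q a (R⊆ (rest⊆R a∈)) (subst (a ≼_) e≡ a≼e)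
        in ⊥-elim (off-polygon a∈ (j′ , j′<q , sym a≡))

      extend : Decomposition rest → Decomposition R
      extend D = record { r = suc r ; polygons = p ∷ polygons ; covers = covers′ ; disjoint = disjoint′ ; inside = inside′ }
        where
          open Decomposition D
          covers′ : ∀ {a} → a ∈ R → Σ (Fin (suc r)) λ i → OnPolygon (Vec.lookup (p ∷ polygons) i) a
          covers′ a∈ with onPolygon? a∈
          ... | yes on = Fin.zero , on
          ... | no off = let (i , on) = covers (∈-reject⁺ R onPolygon? a∈ off) in Fin.suc i , on
          disjoint′ : ∀ i i′ j j′ → j < size (Vec.lookup (p ∷ polygons) i) → j′ < size (Vec.lookup (p ∷ polygons) i′) →
                      vertex (Vec.lookup (p ∷ polygons) i) j ≡ vertex (Vec.lookup (p ∷ polygons) i′) j′ → i ≡ i′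
          disjoint′ Fin.zero     Fin.zero      _ _  _   _    _  = refl
          disjoint′ Fin.zero     (Fin.suc i′) j j′ j<q j′<q eq = ⊥-elim (off-polygon (inside i′ j′ j′<q) (j , j<q , eq))
          disjoint′ (Fin.suc i) Fin.zero      j j′ j<q j′<q eq = ⊥-elim (off-polygon (inside i j j<q) (j′ , j′<q , sym eq))
          disjoint′ (Fin.suc i) (Fin.suc i′) j j′ j<q j′<q eq = cong Fin.suc (disjoint i i′ j j′ j<q j′<q eq)
          inside′ : ∀ i j → j < size (Vec.lookup (p ∷ polygons) i) → vertex (Vec.lookup (p ∷ polygons) i) j ∈ R
          inside′ Fin.zero    j _   = vertex∈R j
          inside′ (Fin.suc i) j j<q = rest⊆R (inside i j j<q)

    decompose : ∀ n R → length R ≤ n → Unique R → (∀ {a} → a ∈ R → a ∈ atoms) → ClosedUnderEdges R → Decomposition R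
    decompose _ [] _ _ _ _ = record { r = 0 ; polygons = [] ; covers = λ () ; disjoint = λ () ; inside = λ () }
    decompose (suc n) (a₀ ∷ R′) len u R⊆ closed =
      extend (decompose n rest (≤-pred (≤-trans rest-shorter len)) (reject-Unique _ onPolygon? u)
                         (R⊆ ∘ rest⊆R) rest-closed)
      where open PeelPolygon a₀ R′ u R⊆ closed

  polygons-of-atoms : Decomposition atoms
  polygons-of-atoms = decompose _ atoms ≤-refl (level-Unique _ _ _) (λ a∈ → a∈) (λ _ a′∈ _ _ _ → a′∈)

  module Isomorphism {r : ℕ} (ps : Vec Polygon r)
                     (covers : ∀ {a} → a ∈ atoms → Σ (Fin r) λ i → OnPolygon (Vec.lookup ps i) a)
                     (disjoint : ∀ i i′ j j′ → j < size (Vec.lookup ps i) → j′ < size (Vec.lookup ps i′) →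
                                 vertex (Vec.lookup ps i) j ≡ vertex (Vec.lookup ps i′) j′ → i ≡ i′) where
    qs : Vec ℕ r
    qs = Vec.map size ps

    private
      infix 4 _⊑_
      _⊑_ : PElem qs → PElem qs → Set
      _⊑_ = _≤Q_

      poly : Fin r → Polygon
      poly = Vec.lookup ps

      size≡ : ∀ i → Vec.lookup qs i ≡ size (poly i)
      size≡ i = lookup-map i size ps

      toℕ< : ∀ i (j : Fin (Vec.lookup qs i)) → toℕ j < size (poly i)
      toℕ< i j = subst (toℕ j <_) (size≡ i) (Finₚ.toℕ<n j)

      position : ∀ i {j} → j < size (poly i) → Fin (Vec.lookup qs i)
      position i j< = fromℕ< (subst (_ <_) (sym (size≡ i)) j<)

      toℕ-position : ∀ i {j} (j< : j < size (poly i)) → toℕ (position i j<) ≡ j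
      toℕ-position i j< = Finₚ.toℕ-fromℕ< _

      ρ-vertex : ∀ i j → ρ (vertex (poly i) j) ≡ 1
      ρ-vertex i j = proj₂ (proj₂ (∈-level⁻ (vertex∈atoms (poly i) j)))

      ρ-side : ∀ i k → ρ (side (poly i) k) ≡ 2
      ρ-side i k = proj₂ (proj₂ (∈-level⁻ (side∈edges (poly i) k)))

    f : PElem qs → Carrier
    f bot        = 0̂
    f top        = Y
    f (vert i j) = vertex (poly i) (toℕ j)
    f (edge i k) = side (poly i) (toℕ k)

    private
      rank : PElem qs → ℕ
      rank bot        = 0
      rank top        = 3
      rank (vert _ _) = 1
      rank (edge _ _) = 2

      ρ-f : ∀ p → ρ (f p) ≡ rank p
      ρ-f bot        = ρ-0̂
      ρ-f top        = ρY≡3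
      ρ-f (vert i j) = ρ-vertex i (toℕ j)
      ρ-f (edge i k) = ρ-side i (toℕ k)

      f≼Y : ∀ p → f p ≼ Y
      f≼Y bot        = 0̂-min Y
      f≼Y top        = ≼-refl
      f≼Y (vert i j) = ∈atoms⇒≼Y (vertex∈atoms (poly i) (toℕ j))
      f≼Y (edge i k) = proj₁ (proj₂ (∈-level⁻ (side∈edges (poly i) (toℕ k))))

      rank-reflects : ∀ {p q} → rank q < rank p → ¬ (f p ≼ f q)
      rank-reflects {p} {q} lt fp≼fq = <⇒≱ lt (subst₂ _≤_ (ρ-f p) (ρ-f q) (ρ-mono fp≼fq))

      Adjacent : ℕ → ℕ → ℕ → Set
      Adjacent n j k = j ≡ k ⊎ j ≡ suc k ⊎ (j ≡ 0 × suc k ≡ n)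

      adjacent-resp : ∀ {n m j k} → n ≡ m → Adjacent n j k → Adjacent m j k
      adjacent-resp refl adj = adj

      f-monotone : ∀ {p q} → p ⊑ q → f p ≼ f q
      f-monotone bot≤           = 0̂-min _
      f-monotone {p} ≤top       = f≼Y p
      f-monotone v≤v            = ≼-refl
      f-monotone e≤e            = ≼-refl
      f-monotone (v≤e {i} {j} {k} adj) =
        Equivalence.from (incidence (poly i) (toℕ j) (toℕ k) (toℕ< i j) (toℕ< i k)) (adjacent-resp (size≡ i) adj)

      same-polygon : ∀ i i′ {j k} → j < size (poly i) → k < size (poly i′) →
                     vertex (poly i) j ≼ side (poly i′) k → i ≡ i′
      same-polygon i i′ {j} {k} j< k< vj≼sk =
        let (j′ , j′< , vj≡) = vertices-closed (poly i′) k k< _ (vertex∈atoms (poly i) j) vj≼sk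
        in disjoint i i′ j j′ j< j′< vj≡

      vert-reflects : ∀ i i′ (j : Fin (Vec.lookup qs i)) (j′ : Fin (Vec.lookup qs i′)) → f (vert i j) ≼ f (vert i′ j′) → vert i j ⊑ vert i′ j′
      vert-reflects i i′ j j′ le with disjoint i i′ (toℕ j) (toℕ j′) (toℕ< i j) (toℕ< i′ j′)
                                        (≼∧ρ≡⇒≡ le (trans (ρ-vertex i _) (sym (ρ-vertex i′ _))))
      ... | refl with Finₚ.toℕ-injective (vertex-injective (poly i) (toℕ j) (toℕ j′) (toℕ< i j) (toℕ< i j′)
                                            (≼∧ρ≡⇒≡ le (trans (ρ-vertex i _) (sym (ρ-vertex i _)))))
      ...   | refl = v≤v

      edge-reflects : ∀ i i′ (k : Fin (Vec.lookup qs i)) (k′ : Fin (Vec.lookup qs i′)) → f (edge i k) ≼ f (edge i′ k′) → edge i k ⊑ edge i′ k′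
      edge-reflects i i′ k k′ le
        with same-polygon i i′ (toℕ< i k) (toℕ< i′ k′)
               (subst (vertex (poly i) (toℕ k) ≼_) (≼∧ρ≡⇒≡ le (trans (ρ-side i _) (sym (ρ-side i′ _))))
                      (proj₁ (ends-of-side (poly i) (toℕ k))))
      ... | refl with Finₚ.toℕ-injective (side-injective (poly i) (toℕ k) (toℕ k′) (toℕ< i k) (toℕ< i k′)
                                            (≼∧ρ≡⇒≡ le (trans (ρ-side i _) (sym (ρ-side i _)))))
      ...   | refl = e≤e

      vert-edge-reflects : ∀ i i′ (j : Fin (Vec.lookup qs i)) (k : Fin (Vec.lookup qs i′)) → f (vert i j) ≼ f (edge i′ k) → vert i j ⊑ edge i′ k
      vert-edge-reflects i i′ j k le with same-polygon i i′ (toℕ< i j) (toℕ< i′ k) le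
      ... | refl = v≤e (adjacent-resp (sym (size≡ i))
                         (Equivalence.to (incidence (poly i) (toℕ j) (toℕ k) (toℕ< i j) (toℕ< i k)) le))

      f-reflects : ∀ p q → f p ≼ f q → p ⊑ q
      f-reflects bot        _           _  = bot≤
      f-reflects _          top         _  = ≤top
      f-reflects top        bot         le = ⊥-elim (rank-reflects {top} {bot} (s≤s z≤n) le)
      f-reflects top        (vert i j)  le = ⊥-elim (rank-reflects {top} {vert i j} (s≤s (s≤s z≤n)) le)
      f-reflects top        (edge i k)  le = ⊥-elim (rank-reflects {top} {edge i k} (s≤s (s≤s (s≤s z≤n))) le)
      f-reflects (vert i j) bot         le = ⊥-elim (rank-reflects {vert i j} {bot} (s≤s z≤n) le)
      f-reflects (edge i k) bot         le = ⊥-elim (rank-reflects {edge i k} {bot} (s≤s z≤n) le)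
      f-reflects (edge i k) (vert i′ j) le = ⊥-elim (rank-reflects {edge i k} {vert i′ j} (s≤s (s≤s z≤n)) le)
      f-reflects (vert i j) (vert i′ j′) le = vert-reflects i i′ j j′ le
      f-reflects (edge i k) (edge i′ k′) le = edge-reflects i i′ k k′ le
      f-reflects (vert i j) (edge i′ k)  le = vert-edge-reflects i i′ j k le

      vertex-of : ∀ {a} → a ∈ atoms → Σ (PElem qs) λ p → f p ≡ a
      vertex-of a∈ = let (i , j , j< , vj≡a) = covers a∈ in
        vert i (position i j<) , trans (cong (vertex (poly i)) (toℕ-position i j<)) vj≡a

      f-onto′ : ∀ n z → ρ z ≡ n → z ≼ Y → Σ (PElem qs) λ p → f p ≡ z
      f-onto′ 0 z ρz≡ _ = bot , sym (ρ≡0⇒≡0̂ ρz≡)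
      f-onto′ 1 z ρz≡ z≼Y = vertex-of (∈-level⁺ (0̂-min z) z≼Y ρz≡)
      f-onto′ 2 z ρz≡ z≼Y with length≡2⇒pair (#atomsBelow ρz≡) (level-Unique _ _ _)
      ... | a , _ , _ , a∈ , _ with ∈-level⁻ a∈
      ...   | _ , a≼z , ρa≡ with covers (∈-level⁺ (0̂-min a) (≼-trans a≼z z≼Y) ρa≡)
      ...     | i , j , j< , vj≡a with sides-closed (poly i) j j< z (∈-level⁺ (0̂-min z) z≼Y ρz≡) (subst (_≼ z) (sym vj≡a) a≼z)
      ...       | k , k< , z≡sk = edge i (position i k<) , trans (cong (side (poly i)) (toℕ-position i k<)) (sym z≡sk)
      f-onto′ 3 z ρz≡ z≼Y = top , sym (≼∧ρ≡⇒≡ z≼Y (trans ρz≡ (sym ρY≡3)))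
      f-onto′ (suc (suc (suc (suc n)))) z ρz≡ z≼Y =
        ⊥-elim (<⇒≱ (subst (3 <_) (sym ρz≡) (s≤s (s≤s (s≤s (s≤s z≤n))))) (subst (ρ z ≤_) ρY≡3 (ρ-mono z≼Y)))

    iso : IsoToInterval P 0̂ Y qs
    iso = record
      { f = f
      ; f-in = λ p → 0̂-min (f p) , f≼Y p
      ; f-onto = λ z _ z≼Y → f-onto′ (ρ z) z refl z≼Y
      ; f-order = λ p q → mk⇔ f-monotone (f-reflects p q) }

  private
    some-atom : Σ Carrier λ a → a ∈ atoms
    some-atom = let (a , a≼Y , ρa≡1) = ShefferProperties.rank-below P S 1 Y (subst (1 ≤_) (sym ρY≡3) (s≤s z≤n))
                in a , ∈-level⁺ (0̂-min a) a≼Y ρa≡1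

    All-2≤size : ∀ {n} (ps : Vec Polygon n) → All (2 ≤_) (Vec.map size ps)
    All-2≤size []       = []
    All-2≤size (p ∷ ps) = 2≤size p ∷ All-2≤size ps

  interval-≅-polygons : Σ ℕ λ r → 1 ≤ r × Σ (Vec ℕ r) λ qs → All (2 ≤_) qs × IsoToInterval P 0̂ Y qs
  interval-≅-polygons =
    r , positive (proj₁ (covers (proj₂ some-atom))) , Vec.map size polygons , All-2≤size polygons , iso
    where
      open Decomposition polygons-of-atoms
      open Isomorphism polygons covers disjoint using (iso)
      positive : ∀ {n} → Fin n → 1 ≤ n
      positive Fin.zero    = s≤s z≤n
      positive (Fin.suc _) = s≤s z≤n

  2≤#edges : 2 ≤ length edges
  2≤#edges = let (a , a∈) = some-atom ; (_ , a≼Y , ρa≡1) = ∈-level⁻ a∈ in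
    subst (_≤ length edges) (#edgesAbove a≼Y ρa≡1)
          (Unique-⊆⇒length≤ (level-Unique _ _ _) (λ e∈ → let (_ , e≼Y , ρe≡) = ∈-level⁻ e∈ in ∈-level⁺ (0̂-min _) e≼Y ρe≡))

module CoatomStructure (P : GradedPoset) (S : IsSheffer P) (eul : IsEulerian P)
                       (B≡ : ∀ n → IsSheffer.B S n ≡ twoPowPred n) where
  open GradedPosetProperties P
  open IsSheffer S
  open ShefferProperties P S
  open EvenLength P S eul B≡
  open OddLength P S eul B≡

  private
    2*suc : ∀ j → 2 * suc j ≡ suc (suc (j + j))
    2*suc j = cong suc (trans (cong (λ t → j + t) (cong suc (+-identityʳ j))) (+-suc j j))

  2≤C3 : 2 ≤ C 3
  2≤C3 = let (Y , ρY≡3) = element-of-rank 3 in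
    subst (2 ≤_) (sym (C≡#coatoms 1 Y ρY≡3)) (RankThree.2≤#edges P S eul B≡ Y ρY≡3)

  C-even≡2 : ∀ m → 1 ≤ m → C (2 * m) ≡ 2
  C-even≡2 (suc j) _ = let (Y , ρY≡) = element-of-rank (suc (suc (j + j))) in
    trans (cong C (2*suc j)) (trans (C≡#coatoms (j + j) Y ρY≡) (#coatoms-even≡2 j Y ρY≡))

  coatoms-share-lower-covers : ∀ m → 2 ≤ m → ∀ y → ρ y ≡ 2 * m → ∀ c d → c ⋖ y → d ⋖ y →
                               ∀ z → ρ z ≡ 2 * m ∸ 2 → (z ⋖ c ⇔ z ⋖ d)
  coatoms-share-lower-covers (suc (suc i)) (s≤s (s≤s z≤n)) y ρy≡ c d c⋖y d⋖y z ρz≡ =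
    mk⇔ (lower-cover-shared i y ρy≡′ c⋖y d⋖y ρz≡′) (lower-cover-shared i y ρy≡′ d⋖y c⋖y ρz≡′)
    where
      ρy≡′ = trans ρy≡ (2*suc (suc i))
      ρz≡′ = trans ρz≡ (cong (_∸ 2) (2*suc (suc i)))

  CoatomPairs : ℕ → ℕ → Carrier → Set
  CoatomPairs r k y = Σ (List (Carrier × Carrier)) λ ps →
    length ps ≡ k × Unique (flattenPairs ps) × (∀ z → z ⋖ y ⇔ z ∈ flattenPairs ps) × L.All (SharedLowerCovers r) ps

  private
    matching⇒CoatomPairs : ∀ i y (ρy≡ : ρ y ≡ suc (suc (suc (suc i + suc i)))) {k}
                           (M : PerfectMatching SameLowerCovers (coatoms i y ρy≡)) →
                           length (proj₁ M) ≡ k → CoatomPairs (suc (suc i + suc i)) k y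
    matching⇒CoatomPairs i y ρy≡ (ps , ps-Unique , coatoms⇔ps , ps~) #ps≡k =
      ps , #ps≡k , ps-Unique ,
      (λ z → mk⇔ (Equivalence.to coatoms⇔ps ∘ ⋖⇒∈coatoms i y ρy≡) (∈coatoms⇒⋖ i y ρy≡ ∘ Equivalence.from coatoms⇔ps)) ,
      L.tabulate λ p∈ → shared-lower-covers i y ρy≡ (Equivalence.from coatoms⇔ps (∈-flattenPairs p∈)) (L.lookup ps~ p∈)

  odd-coatom-pairs : ∀ m → 2 ≤ m →
    Σ ℕ λ k → 1 ≤ k × C (suc (2 * m)) ≡ 2 * k × (∀ y → ρ y ≡ suc (2 * m) → CoatomPairs (2 * m ∸ 1) k y)
  odd-coatom-pairs (suc (suc i)) (s≤s (s≤s z≤n)) = k , 1≤k , C≡2k , pairs-of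
    where
      j = suc i
      t = suc (j + j)
      t≡ : t ≡ 2 * suc j ∸ 1
      t≡ = sym (cong (_∸ 1) (2*suc j))
      #pairs : ∀ y → ρ y ≡ suc (suc t) → ℕ
      #pairs y ρy≡ = length (proj₁ (coatom-pairing i y ρy≡))
      C≡#pairs : ∀ y (ρy≡ : ρ y ≡ suc (suc t)) → C (suc (suc t)) ≡ #pairs y ρy≡ + #pairs y ρy≡
      C≡#pairs y ρy≡ = trans (C≡#coatoms t y ρy≡) (length-PerfectMatching SameLowerCovers (level-Unique _ _ _) (coatom-pairing i y ρy≡))
      y₀ = element-of-rank (suc (suc t))
      k = #pairs (proj₁ y₀) (proj₂ y₀)
      C≡2k : C (suc (2 * suc j)) ≡ 2 * k
      C≡2k = trans (cong (C ∘ suc) (2*suc j)) (trans (C≡#pairs (proj₁ y₀) (proj₂ y₀)) (cong (λ t → k + t) (sym (+-identityʳ k))))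
      1≤k : 1 ≤ k
      1≤k = let (c , _ , c⋖y₀) = cover-below (0̂-min (proj₁ y₀)) y₀≢0̂ in
        ∈-flattenPairs⇒nonempty (Equivalence.to (proj₁ (proj₂ (proj₂ (coatom-pairing i _ (proj₂ y₀)))))
                                                (⋖⇒∈coatoms i _ (proj₂ y₀) c⋖y₀))
        where
          y₀≢0̂ : 0̂ ≢ proj₁ y₀
          y₀≢0̂ 0̂≡y₀ = 1+n≢0 (trans (sym (proj₂ y₀)) (trans (cong ρ (sym 0̂≡y₀)) ρ-0̂))
      pairs-of : ∀ y → ρ y ≡ suc (2 * suc j) → CoatomPairs (2 * suc j ∸ 1) k y
      pairs-of y ρy≡ = let ρy≡′ = trans ρy≡ (cong suc (2*suc j)) in
        subst (λ r → CoatomPairs r k y) t≡ (matching⇒CoatomPairs i y ρy≡′ (coatom-pairing i y ρy≡′)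
          (m+m≡n+n⇒m≡n _ _ (trans (sym (C≡#pairs y ρy≡′)) (C≡#pairs (proj₁ y₀) (proj₂ y₀)))))

theorem3p11 : (P : GradedPoset) (S : IsSheffer P) → IsEulerian P →
  (∀ n → IsSheffer.B S n ≡ twoPowPred n) →
  let open GradedPoset P
      open IsSheffer S
  in
  -- (i)
  (2 ≤ C 3 ×
    (∀ y → ρ y ≡ 3 →
      Σ ℕ λ r → 1 ≤ r × Σ (Vec ℕ r) λ qs → All (2 ≤_) qs × IsoToInterval P 0̂ y qs))
  -- (ii)
  × (∀ m → 2 ≤ m →
      C (2 * m) ≡ 2 ×
      (∀ y → ρ y ≡ 2 * m → ∀ c d → c ⋖ y → d ⋖ y →
        ∀ z → ρ z ≡ 2 * m ∸ 2 → (z ⋖ c ⇔ z ⋖ d)))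
  -- (iii)
  × (∀ m → 2 ≤ m →
      Σ ℕ λ k → 1 ≤ k × C (suc (2 * m)) ≡ 2 * k ×
      (∀ y → ρ y ≡ suc (2 * m) →
        Σ (List (Carrier × Carrier)) λ ps →
          length ps ≡ k ×
          Unique (flattenPairs ps) ×
          (∀ z → z ⋖ y ⇔ z ∈ flattenPairs ps) ×
          L.All (λ cd →
              Σ Carrier λ a → Σ Carrier λ b →
                a ≢ b × ρ a ≡ 2 * m ∸ 1 × ρ b ≡ 2 * m ∸ 1 ×
                (∀ z → (z ⋖ proj₁ cd ⇔ (z ≡ a ⊎ z ≡ b)) × (z ⋖ proj₂ cd ⇔ (z ≡ a ⊎ z ≡ b)))) ps))
theorem3p11 P S eul B≡ =
  (2≤C3 , RankThree.interval-≅-polygons P S eul B≡) ,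
  (λ m 2≤m → C-even≡2 m (≤-trans (s≤s z≤n) 2≤m) , coatoms-share-lower-covers m 2≤m) ,
  odd-coatom-pairs
  where open CoatomStructure P S eul B≡
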